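{- For every $n\ge 1$, $$R_n(x)=\varphi(n)\Big(1-x^n+\sum_{d\mid n}\frac{\mu(d)}{\varphi(d)}\Psi_d\big(x^{n/d}\big)\Big),$$ where $R_n(x)=\sum_{k=0}^{n-1} c_n(k)x^k$ and $\Psi_d(x)=\sum_{1\le j\le d,\ \gcd(j,d)=1}x^j$.
   Context: For integers $n\ge 1$ and $k$, the Ramanujan sum $c_n(k)$ is the sum of the $k$th powers of the primitive $n$th roots of unity, i.e. $c_n(k)=\sum_{1\le j\le n,\ \gcd(j,n)=1} e^{2\pi \sqrt{ -1}\, jk/n}$. $\varphi$ is Euler's function and $\mu$ the Möbius function. -}

module Defs where

open import Level using (Level; _⊔_)
open import Data.Nat as ℕ using (ℕ; zero; suc; _∸_)
open import Data.Nat.GCD using (gcd)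
open import Data.Nat.Divisibility using (_∣?_)
open import Data.Nat.Primality using (prime?)
open import Data.Integer as ℤ using (ℤ; +_; -[1+_])
open import Data.Rational as ℚ using (ℚ)
open import Data.List using (List; filter; map; foldr; length; upTo)
open import Data.Bool.ListAction using (any)
open import Data.Bool using (if_then_else_)
open import Relation.Nullary.Decidable using (⌊_⌋)
open import Algebra.Bundles using (CommutativeRing; Semiring)
open import Relation.Nullary using (¬_)
open import Relation.Binary.PropositionalEquality using (_≡_)
open import Data.Sum using (_⊎_)

-- [a, b] = a , a+1 , … , b   (empty if b < a)
range : ℕ → ℕ → List ℕ
range a b = map (a ℕ.+_) (upTo (suc b ∸ a))

φ : ℕ → ℕ
φ n = length (filter (λ j → gcd j n ℕ.≟ 1) (range 1 n))

squarefulB : ℕ → Data.Bool.Bool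
squarefulB n = any (λ m → ⌊ (m ℕ.* m) ∣? n ⌋) (range 2 n)

numPrimeDivisors : ℕ → ℕ
numPrimeDivisors n = length (filter (λ p → prime? p Relation.Nullary.Decidable.×-dec (p ∣? n)) (range 2 n))

μ : ℕ → ℤ
μ n = if squarefulB n then + 0 else (ℤ.- ℤ.1ℤ) ℤ.^ numPrimeDivisors n

divisors : ℕ → List ℕ
divisors n = filter (λ d → d ∣? n) (range 1 n)

_^ℚ_ : ℚ → ℕ → ℚ
y ^ℚ zero = ℚ.1ℚ
y ^ℚ suc m = y ℚ.* (y ^ℚ m)

-- n / d in ℕ (only used with d ≥ 1)
_divℕ_ : ℕ → ℕ → ℕ
n divℕ zero = 0
n divℕ suc d = n ℕ./ suc d

sumℚ : List ℚ → ℚ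
sumℚ = foldr ℚ._+_ ℚ.0ℚ

-- a / b as a rational number (only used with b ≥ 1; b = 0 gives 0 by convention)
_÷ℚ_ : ℤ → ℕ → ℚ
a ÷ℚ zero = ℚ.0ℚ
a ÷ℚ suc b = a ℚ./ suc b

Ψ : ℕ → ℚ → ℚ
Ψ d y = sumℚ (map (λ j → y ^ℚ j) (filter (λ j → gcd j d ℕ.≟ 1) (range 1 d)))

Rpoly : ℕ → (ℕ → ℤ) → ℚ → ℚ
Rpoly n c x = sumℚ (map (λ k → (c k ℚ./ 1) ℚ.* (x ^ℚ k)) (upTo n))

RHS : ℕ → ℚ → ℚ
RHS n x = ((+ φ n) ℚ./ 1) ℚ.* ((ℚ.1ℚ ℚ.- (x ^ℚ n)) ℚ.+
  sumℚ (map (λ d → (μ d ÷ℚ φ d) ℚ.* Ψ d (x ^ℚ (n divℕ d))) (divisors n)))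

module _ {a ℓ : Level} (R : CommutativeRing a ℓ) where
  open CommutativeRing R
  open import Algebra.Definitions.RawSemiring (Semiring.rawSemiring semiring) using (_^_) renaming (_×_ to _·_)

  ℤ→R : ℤ → Carrier
  ℤ→R (+ m) = m · 1#
  ℤ→R -[1+ m ] = - (suc m · 1#)

  IsIntegralDomain : Set (a ⊔ ℓ)
  IsIntegralDomain = ∀ u v → u * v ≈ 0# → u ≈ 0# ⊎ v ≈ 0#

  HasCharZero : Set ℓ
  HasCharZero = ∀ m → m · 1# ≈ 0# → m ≡ 0

  IsPrimitiveRoot : ℕ → Carrier → Set ℓ
  IsPrimitiveRoot n ζ = ζ ^ n ≈ 1# × (∀ m → 1 ℕ.≤ m → m ℕ.< n → ¬ (ζ ^ m ≈ 1#))
    where open import Data.Product using (_×_)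

  -- Σ_{1 ≤ j ≤ n, gcd(j,n)=1} ζ^(jk) : the sum of the k-th powers of the
  -- primitive n-th roots of unity ζ^j
  ramSum : ℕ → Carrier → ℕ → Carrier
  ramSum n ζ k = foldr _+_ 0# (map (λ j → ζ ^ (j ℕ.* k)) (filter (λ j → gcd j n ℕ.≟ 1) (range 1 n)))

module Submission where

-- The coefficients of R_n are given by Hölder's formula φ(d) c_n(k) = φ(n) μ(d), d = n / gcd(k, n),
-- proved by induction along the prime factorisation of n. For n = p·m the residues modulo n fall
-- into p blocks of residues modulo m, so the sum defining c_n(k) becomes a geometric sum in
-- ω = ζ^(mk) times c_m for the primitive m-th root ζ^p; the geometric sum is p if p ∣ k and 0
-- otherwise, ω being then a p-th root of unity ≠ 1 in a domain. When p ∤ m the blocks also contain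
-- the p-multiples, which contribute c_m; the recurrences of φ and μ at p·m match these. In
-- characteristic zero the formula descends from R to ℤ. Finally, trading the term k = 0 for k = n
-- (both have d = 1) and grouping the terms c_n(k) x^k by d gives the sum over d ∣ n, since k has
-- d = n / gcd(k, n) exactly when k = (n/d)·j with gcd(j, d) = 1.

open import Defs
open import Level using (Level)
open import Data.Nat using (ℕ; _≤_; _≥_)
open import Data.Integer using (ℤ)
open import Data.Rational using (ℚ)
open import Algebra.Bundles using (CommutativeRing; CommutativeSemiring; Semiring; AbelianGroup)
open import Relation.Binary.PropositionalEquality using (_≡_)

module ListLemmas where

  open import Data.Nat using (ℕ; zero; suc; _+_; _<_; z≤n; s≤s)
  open import Data.Nat.Properties using (+-suc; +-comm)
  open import Data.List using (List; []; _∷_; _++_; [_]; map; filter; applyUpTo; length)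
  open import Data.List.Properties using (map-upTo; map-applyUpTo; filter-reject)
  open import Relation.Nullary using (yes; no; ¬_)
  open import Relation.Nullary.Decidable using (_×-dec_)
  open import Relation.Unary using (Pred; Decidable; _≐_)
  open import Data.Product using (_×_; _,_; proj₁; proj₂; swap)
  open import Data.Sum using (_⊎_; inj₁; inj₂)
  open import Data.Empty using (⊥-elim)
  open import Function using (_∘_; _⇔_; Equivalence; mk⇔)
  import Function.Construct.Identity as ⇔
  open import Relation.Binary.PropositionalEquality hiding ([_])
  open ≡-Reasoning

  private variable
    a p q r : Level
    A B : Set a

  ⇔⇒≐ : {P : Pred A p} {Q : Pred A q} → (∀ x → P x ⇔ Q x) → P ≐ Q
  ⇔⇒≐ e = (λ {x} → Equivalence.to (e x)) , (λ {x} → Equivalence.from (e x))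

  applyUpTo-+ : ∀ (f : ℕ → A) m n → applyUpTo f (m + n) ≡ applyUpTo f m ++ applyUpTo (λ x → f (m + x)) n
  applyUpTo-+ f zero n = refl
  applyUpTo-+ f (suc m) n = cong (f 0 ∷_) (applyUpTo-+ (f ∘ suc) m n)

  applyUpTo-cong : ∀ {f g : ℕ → A} → (∀ x → f x ≡ g x) → ∀ n → applyUpTo f n ≡ applyUpTo g n
  applyUpTo-cong e zero = refl
  applyUpTo-cong e (suc n) = cong₂ _∷_ (e 0) (applyUpTo-cong (e ∘ suc) n)

  range1≡applyUpTo : ∀ n → range 1 n ≡ applyUpTo suc n
  range1≡applyUpTo = map-upTo suc

  range1-+ : ∀ m n → range 1 (m + n) ≡ range 1 m ++ map (m +_) (range 1 n)
  range1-+ m n = begin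
    range 1 (m + n)                                    ≡⟨ range1≡applyUpTo (m + n) ⟩
    applyUpTo suc (m + n)                              ≡⟨ applyUpTo-+ suc m n ⟩
    applyUpTo suc m ++ applyUpTo (λ x → suc (m + x)) n ≡⟨ cong₂ _++_ (sym (range1≡applyUpTo m)) shifted ⟩
    range 1 m ++ map (m +_) (range 1 n)                ∎
    where
    shifted : applyUpTo (λ x → suc (m + x)) n ≡ map (m +_) (range 1 n)
    shifted = begin
      applyUpTo (λ x → suc (m + x)) n ≡⟨ applyUpTo-cong (λ x → sym (+-suc m x)) n ⟩
      applyUpTo (λ x → m + suc x) n   ≡⟨ map-applyUpTo suc (m +_) n ⟨
      map (m +_) (applyUpTo suc n)    ≡⟨ cong (map (m +_)) (range1≡applyUpTo n) ⟨
      map (m +_) (range 1 n)          ∎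

  range1-suc : ∀ n → range 1 (suc n) ≡ 1 ∷ map suc (range 1 n)
  range1-suc n = begin
    range 1 (suc n)               ≡⟨ range1≡applyUpTo (suc n) ⟩
    1 ∷ applyUpTo (suc ∘ suc) n   ≡⟨ cong (1 ∷_) (map-applyUpTo suc suc n) ⟨
    1 ∷ map suc (applyUpTo suc n) ≡⟨ cong (λ l → 1 ∷ map suc l) (range1≡applyUpTo n) ⟨
    1 ∷ map suc (range 1 n)       ∎

  range1-∷ʳ : ∀ n → range 1 (suc n) ≡ range 1 n ++ [ suc n ]
  range1-∷ʳ n = begin
    range 1 (suc n)           ≡⟨ cong (range 1) (+-comm 1 n) ⟩
    range 1 (n + 1)           ≡⟨ range1-+ n 1 ⟩
    range 1 n ++ [ n + 1 ]    ≡⟨ cong (λ m → range 1 n ++ [ m ]) (+-comm n 1) ⟩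
    range 1 n ++ [ suc n ]    ∎

  filter-none-applyUpTo : {P : Pred A p} (P? : Decidable P) (f : ℕ → A) (n : ℕ) →
    (∀ x → x < n → ¬ P (f x)) → filter P? (applyUpTo f n) ≡ []
  filter-none-applyUpTo P? f zero _ = refl
  filter-none-applyUpTo P? f (suc n) ¬P = trans (filter-reject P? (¬P 0 (s≤s z≤n)))
    (filter-none-applyUpTo P? (f ∘ suc) n (λ x x<n → ¬P (suc x) (s≤s x<n)))

  module _ {P : Pred A p} (P? : Decidable P) where

    filter-map : (f : B → A) (l : List B) → filter P? (map f l) ≡ map f (filter (P? ∘ f) l)
    filter-map f [] = refl
    filter-map f (x ∷ l) with P? (f x)
    ... | yes _ = cong (f x ∷_) (filter-map f l)
    ... | no _ = filter-map f l

    module _ {Q : Pred A q} (Q? : Decidable Q) {R : Pred A r} (R? : Decidable R) where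

      filter-filter : (∀ x → (P x × Q x) ⇔ R x) → ∀ l → filter Q? (filter P? l) ≡ filter R? l
      filter-filter e [] = refl
      filter-filter e (x ∷ l) with P? x | R? x
      ... | yes px | yes rx with Q? x
      ...   | yes _ = cong (x ∷_) (filter-filter e l)
      ...   | no ¬qx = ⊥-elim (¬qx (proj₂ (Equivalence.from (e x) rx)))
      filter-filter e (x ∷ l) | yes px | no ¬rx with Q? x
      ...   | yes qx = ⊥-elim (¬rx (Equivalence.to (e x) (px , qx)))
      ...   | no _ = filter-filter e l
      filter-filter e (x ∷ l) | no ¬px | yes rx = ⊥-elim (¬px (proj₁ (Equivalence.from (e x) rx)))
      filter-filter e (x ∷ l) | no _ | no _ = filter-filter e l

      length-filter-⊎ : (∀ x → R x ⇔ (P x ⊎ Q x)) → (∀ x → ¬ (P x × Q x)) → ∀ l →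
        length (filter R? l) ≡ length (filter P? l) + length (filter Q? l)
      length-filter-⊎ e disj [] = refl
      length-filter-⊎ e disj (x ∷ l) with P? x | Q? x | R? x
      ... | yes px | yes qx | _ = ⊥-elim (disj x (px , qx))
      ... | yes _ | no _ | yes _ = cong suc (length-filter-⊎ e disj l)
      ... | no _ | yes _ | yes _ = trans (cong suc (length-filter-⊎ e disj l)) (sym (+-suc _ _))
      ... | no _ | no _ | no _ = length-filter-⊎ e disj l
      ... | yes px | no _ | no ¬rx = ⊥-elim (¬rx (Equivalence.from (e x) (inj₁ px)))
      ... | no _ | yes qx | no ¬rx = ⊥-elim (¬rx (Equivalence.from (e x) (inj₂ qx)))
      ... | no ¬px | no ¬qx | yes rx with Equivalence.to (e x) rx
      ...   | inj₁ px = ⊥-elim (¬px px)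
      ...   | inj₂ qx = ⊥-elim (¬qx qx)

  filter-comm : {P : Pred A p} {Q : Pred A q} (P? : Decidable P) (Q? : Decidable Q) →
    ∀ l → filter Q? (filter P? l) ≡ filter P? (filter Q? l)
  filter-comm P? Q? l = trans (filter-filter P? Q? (λ x → P? x ×-dec Q? x) (λ _ → ⇔.⇔-id _) l)
    (sym (filter-filter Q? P? (λ x → P? x ×-dec Q? x) (λ _ → mk⇔ swap swap) l))

module Arithmetic where

  open ListLemmas
  open import Data.Nat as ℕ using (ℕ; zero; suc; _+_; _*_; _≤_; _<_; z≤n; s≤s)
  open import Data.Nat.Properties
  open import Data.Nat.GCD
  open import Data.Nat.Divisibility
  open import Data.Nat.Coprimality as Coprime using (Coprime; coprime⇒gcd≡1; gcd≡1⇒coprime; coprime-divisor)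
  open import Data.Nat.Primality
  open import Data.List using (List; []; _∷_; _++_; [_]; map; filter)
  open import Data.List.Properties using (filter-++; filter-none; filter-accept; filter-≐; map-∘; map-cong)
  open import Data.List.Relation.Unary.All using (All; []; _∷_)
  open import Data.List.Relation.Unary.All.Properties using (++⁺)
  open import Relation.Nullary using (¬_; ¬?)
  open import Relation.Nullary.Negation using (contradiction)
  open import Relation.Unary using (Decidable; _≐_)
  open import Data.Product using (_×_; _,_)
  open import Data.Sum using (inj₁; inj₂)
  open import Function using (_∘_; _⇔_; mk⇔)
  open import Function.Construct.Symmetry using (⇔-sym)
  open import Relation.Binary.PropositionalEquality hiding ([_])
  open ≡-Reasoning

  prime⇒≥2 : ∀ {p} → Prime p → 2 ≤ p
  prime⇒≥2 {p} pp = ℕ.nonTrivial⇒n>1 p {{prime⇒nonTrivial pp}}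

  prime⇒≥1 : ∀ {p} → Prime p → 1 ≤ p
  prime⇒≥1 pp = ≤-trans (s≤s z≤n) (prime⇒≥2 pp)

  factor-positiveˡ : ∀ {g d m} → g * d ≡ m → 1 ≤ m → 1 ≤ g
  factor-positiveˡ {zero} refl ()
  factor-positiveˡ {suc g} _ _ = s≤s z≤n

  factor-positiveʳ : ∀ {g d m} → g * d ≡ m → 1 ≤ m → 1 ≤ d
  factor-positiveʳ {g} {d} e = factor-positiveˡ (trans (*-comm d g) e)

  coprime-*ʳ : ∀ {a b c} → Coprime a b → Coprime a c → Coprime a (b * c)
  coprime-*ʳ ab ac (i∣a , i∣bc) = ac (i∣a , coprime-divisor (λ (j∣i , j∣b) → ab (∣-trans j∣i i∣a , j∣b)) i∣bc)

  coprime-∣ʳ : ∀ {a b c} → Coprime a b → c ∣ b → Coprime a c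
  coprime-∣ʳ ab c∣b (i∣a , i∣c) = ab (i∣a , ∣-trans i∣c c∣b)

  coprime-∣ˡ : ∀ {a b c} → Coprime a b → c ∣ a → Coprime c b
  coprime-∣ˡ ab c∣a (i∣c , i∣b) = ab (∣-trans i∣c c∣a , i∣b)

  prime∤⇒coprime : ∀ {p a} → Prime p → ¬ p ∣ a → Coprime p a
  prime∤⇒coprime pp p∤a (i∣p , i∣a) with prime⇒irreducible pp i∣p
  ... | inj₁ i≡1 = i≡1
  ... | inj₂ refl = contradiction i∣a p∤a

  gcd[m+x,m]≡1⇔gcd[x,m]≡1 : ∀ m x → gcd (m + x) m ≡ 1 ⇔ gcd x m ≡ 1
  gcd[m+x,m]≡1⇔gcd[x,m]≡1 m x = mk⇔
    (λ g → coprime⇒gcd≡1 {x} {m} (λ (i∣x , i∣m) → gcd≡1⇒coprime {m + x} g (∣m∣n⇒∣m+n i∣m i∣x , i∣m)))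
    (λ g → coprime⇒gcd≡1 {m + x} (Coprime.coprime-+ (gcd≡1⇒coprime {x} g)))

  gcd[p*j,m]≡1⇔gcd[j,m]≡1 : ∀ {p m} j → Prime p → ¬ p ∣ m → gcd (p * j) m ≡ 1 ⇔ gcd j m ≡ 1
  gcd[p*j,m]≡1⇔gcd[j,m]≡1 {p} j pp p∤m = mk⇔
    (λ g → coprime⇒gcd≡1 {j} (coprime-∣ˡ (gcd≡1⇒coprime {p * j} g) (n∣m*n p)))
    (λ g → coprime⇒gcd≡1 {p * j} λ (i∣pj , i∣m) →
      gcd≡1⇒coprime {j} g (coprime-divisor (Coprime.sym (coprime-∣ʳ (prime∤⇒coprime pp p∤m) i∣m)) i∣pj , i∣m))

  gcd[j,p*m]≡1⇔gcd[j,m]≡1×p∤j : ∀ {p m} j → Prime p → gcd j (p * m) ≡ 1 ⇔ (gcd j m ≡ 1 × ¬ p ∣ j)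
  gcd[j,p*m]≡1⇔gcd[j,m]≡1×p∤j {p} {m} j pp = mk⇔
    (λ g → coprime⇒gcd≡1 {j} (coprime-∣ʳ (gcd≡1⇒coprime {j} g) (n∣m*n p)) ,
           λ p∣j → ¬prime[1] (subst Prime (gcd≡1⇒coprime {j} g (p∣j , m∣m*n m)) pp))
    (λ (g , p∤j) → coprime⇒gcd≡1 {j} (coprime-*ʳ (Coprime.sym (prime∤⇒coprime pp p∤j)) (gcd≡1⇒coprime {j} g)))

  gcd[j,p*m]≡1⇔gcd[j,m]≡1 : ∀ {p m} j → p ∣ m → gcd j (p * m) ≡ 1 ⇔ gcd j m ≡ 1
  gcd[j,p*m]≡1⇔gcd[j,m]≡1 {p} {m} j p∣m = mk⇔
    (λ g → coprime⇒gcd≡1 {j} (coprime-∣ʳ (gcd≡1⇒coprime {j} g) (n∣m*n p)))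
    (λ g → coprime⇒gcd≡1 {j} (coprime-*ʳ (coprime-∣ʳ (gcd≡1⇒coprime {j} g) p∣m) (gcd≡1⇒coprime {j} g)))

  gcd[a,c*n]≡gcd[a,n] : ∀ {c a} n → Coprime c a → gcd a (c * n) ≡ gcd a n
  gcd[a,c*n]≡gcd[a,n] {c} {a} n ca = GCD.unique (gcd-GCD a (c * n)) (GCD.is
    (gcd[m,n]∣m a n , ∣-trans (gcd[m,n]∣n a n) (n∣m*n c))
    (λ (i∣a , i∣cn) → gcd-greatest i∣a (coprime-divisor (Coprime.sym (coprime-∣ʳ ca i∣a)) i∣cn)))

  gcd[q*p,p*m]≡p*gcd[q,m] : ∀ p q m → gcd (q * p) (p * m) ≡ p * gcd q m
  gcd[q*p,p*m]≡p*gcd[q,m] p q m = trans (cong (λ z → gcd z (p * m)) (*-comm q p)) (sym (c*gcd[m,n]≡gcd[cm,cn] p q m))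

  coprime? : (m : ℕ) → Decidable (λ j → gcd j m ≡ 1)
  coprime? m j = gcd j m ℕ.≟ 1

  coprimes : ℕ → List ℕ
  coprimes m = filter (coprime? m) (range 1 m)

  filter-∣-range1 : ∀ e → 1 ≤ e → ∀ d → filter (e ∣?_) (range 1 (e * d)) ≡ map (e *_) (range 1 d)
  filter-∣-range1 e e≥1 zero rewrite *-zeroʳ e = refl
  filter-∣-range1 e e≥1 (suc d) = begin
    filter (e ∣?_) (range 1 (e * suc d))                                     ≡⟨ cong (λ z → filter (e ∣?_) (range 1 z)) (*-suc e d) ⟩
    filter (e ∣?_) (range 1 (e + e * d))                                     ≡⟨ cong (filter (e ∣?_)) (range1-+ e (e * d)) ⟩
    filter (e ∣?_) (range 1 e ++ map (e +_) (range 1 (e * d)))               ≡⟨ filter-++ (e ∣?_) (range 1 e) _ ⟩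
    filter (e ∣?_) (range 1 e) ++ filter (e ∣?_) (map (e +_) (range 1 (e * d))) ≡⟨ cong₂ _++_ (only-e e≥1) (filter-map (e ∣?_) (e +_) (range 1 (e * d))) ⟩
    e ∷ map (e +_) (filter (λ x → e ∣? (e + x)) (range 1 (e * d)))          ≡⟨ cong (λ l → e ∷ map (e +_) l) (filter-≐ (λ x → e ∣? (e + x)) (e ∣?_) e∣e+x≐e∣x (range 1 (e * d))) ⟩
    e ∷ map (e +_) (filter (e ∣?_) (range 1 (e * d)))                        ≡⟨ cong (λ l → e ∷ map (e +_) l) (filter-∣-range1 e e≥1 d) ⟩
    e ∷ map (e +_) (map (e *_) (range 1 d))                                  ≡⟨ cong₂ _∷_ (sym (*-identityʳ e)) (sym (map-∘ (range 1 d))) ⟩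
    e * 1 ∷ map (λ x → e + e * x) (range 1 d)                                ≡⟨ cong (e * 1 ∷_) (map-cong (λ x → sym (*-suc e x)) (range 1 d)) ⟩
    e * 1 ∷ map (λ x → e * suc x) (range 1 d)                                ≡⟨ cong (e * 1 ∷_) (map-∘ (range 1 d)) ⟩
    map (e *_) (1 ∷ map suc (range 1 d))                                     ≡⟨ cong (map (e *_)) (range1-suc d) ⟨
    map (e *_) (range 1 (suc d))                                             ∎
    where
    e∣e+x≐e∣x : (λ x → e ∣ e + x) ≐ (e ∣_)
    e∣e+x≐e∣x = ⇔⇒≐ (λ x → mk⇔ (λ h → ∣m+n∣m⇒∣n h ∣-refl) (∣m∣n⇒∣m+n ∣-refl))
    below : ∀ {e} k → k < e → All (λ x → ¬ e ∣ x) (range 1 k)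
    below zero _ = []
    below (suc k) k<e rewrite range1-∷ʳ k =
      ++⁺ (below k (<-trans (n<1+n k) k<e)) ((λ e∣k → <⇒≱ k<e (∣⇒≤ e∣k)) ∷ [])
    only-e : ∀ {e} → 1 ≤ e → filter (e ∣?_) (range 1 e) ≡ [ e ]
    only-e {suc e} _ = begin
      filter (suc e ∣?_) (range 1 (suc e))                             ≡⟨ cong (filter (suc e ∣?_)) (range1-∷ʳ e) ⟩
      filter (suc e ∣?_) (range 1 e ++ [ suc e ])                      ≡⟨ filter-++ (suc e ∣?_) (range 1 e) [ suc e ] ⟩
      filter (suc e ∣?_) (range 1 e) ++ filter (suc e ∣?_) [ suc e ]   ≡⟨ cong₂ _++_ (filter-none (suc e ∣?_) (below e ≤-refl)) (filter-accept (suc e ∣?_) ∣-refl) ⟩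
      [ suc e ]                                                        ∎

  module _ {p m : ℕ} (pp : Prime p) (p∤m : ¬ p ∣ m) where

    filter-∣-coprimes : filter (p ∣?_) (filter (coprime? m) (range 1 (p * m))) ≡ map (p *_) (coprimes m)
    filter-∣-coprimes = begin
      filter (p ∣?_) (filter (coprime? m) (range 1 (p * m)))   ≡⟨ filter-comm (coprime? m) (p ∣?_) (range 1 (p * m)) ⟩
      filter (coprime? m) (filter (p ∣?_) (range 1 (p * m)))   ≡⟨ cong (filter (coprime? m)) (filter-∣-range1 p (prime⇒≥1 pp) m) ⟩
      filter (coprime? m) (map (p *_) (range 1 m))             ≡⟨ filter-map (coprime? m) (p *_) (range 1 m) ⟩
      map (p *_) (filter (λ j → coprime? m (p * j)) (range 1 m)) ≡⟨ cong (map (p *_)) (filter-≐ _ (coprime? m) gcd[pj,m]≡1≐gcd[j,m]≡1 (range 1 m)) ⟩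
      map (p *_) (coprimes m)                                  ∎
      where
      gcd[pj,m]≡1≐gcd[j,m]≡1 : (λ j → gcd (p * j) m ≡ 1) ≐ (λ j → gcd j m ≡ 1)
      gcd[pj,m]≡1≐gcd[j,m]≡1 = ⇔⇒≐ (λ j → gcd[p*j,m]≡1⇔gcd[j,m]≡1 j pp p∤m)

    filter-∤-coprimes : filter (¬? ∘ (p ∣?_)) (filter (coprime? m) (range 1 (p * m))) ≡ coprimes (p * m)
    filter-∤-coprimes = filter-filter (coprime? m) (¬? ∘ (p ∣?_)) (coprime? (p * m))
      (λ j → ⇔-sym (gcd[j,p*m]≡1⇔gcd[j,m]≡1×p∤j j pp)) (range 1 (p * m))

module Sums {c ℓ} (S : CommutativeSemiring c ℓ) where

  open import Data.Nat as ℕ using (ℕ; zero; suc)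
  open import Data.List using (List; []; _∷_; _++_; [_]; map; foldr; filter; upTo)
  open import Data.List.Properties using (map-upTo; upTo-∷ʳ; filter-++)
  open import Data.List.Membership.Propositional using (_∈_)
  open import Data.List.Relation.Unary.Any using (here; there)
  import Data.List.Relation.Unary.All as All
  open import Data.List.Relation.Unary.Unique.Propositional using (Unique)
  open import Data.List.Relation.Unary.AllPairs using (_∷_)
  open import Relation.Nullary using (yes; no; ¬?)
  open import Relation.Unary using (Decidable)
  open import Relation.Binary.Definitions using (DecidableEquality)
  open import Function using (_∘_)
  open import Data.Empty using (⊥-elim)
  import Relation.Binary.PropositionalEquality as ≡
  open ≡ using (_≡_)
  open CommutativeSemiring S renaming (Carrier to C)
  open import Algebra.Definitions.RawSemiring rawSemiring using (_×_)
  open import Relation.Binary.Reasoning.Setoid setoid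

  private variable
    a b : Level
    A : Set a
    B : Set b

  private
    x+[y+z]≈y+[x+z] : ∀ x y z → x + (y + z) ≈ y + (x + z)
    x+[y+z]≈y+[x+z] x y z = trans (sym (+-assoc x y z)) (trans (+-congʳ (+-comm x y)) (+-assoc y x z))

  Σ : List A → (A → C) → C
  Σ l f = foldr _+_ 0# (map f l)

  Σ-cong∈ : ∀ (l : List A) {f g} → (∀ {x} → x ∈ l → f x ≈ g x) → Σ l f ≈ Σ l g
  Σ-cong∈ [] e = refl
  Σ-cong∈ (x ∷ l) e = +-cong (e (here ≡.refl)) (Σ-cong∈ l (e ∘ there))

  Σ-cong : ∀ (l : List A) {f g} → (∀ x → f x ≈ g x) → Σ l f ≈ Σ l g
  Σ-cong l e = Σ-cong∈ l (λ {x} _ → e x)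

  Σ-map : ∀ (g : B → A) (l : List B) f → Σ (map g l) f ≡ Σ l (f ∘ g)
  Σ-map g [] f = ≡.refl
  Σ-map g (x ∷ l) f = ≡.cong (f (g x) +_) (Σ-map g l f)

  Σ-zero : ∀ (l : List A) → Σ l (λ _ → 0#) ≈ 0#
  Σ-zero [] = refl
  Σ-zero (x ∷ l) = trans (+-identityˡ _) (Σ-zero l)

  Σ-++ : ∀ (l l′ : List A) f → Σ (l ++ l′) f ≈ Σ l f + Σ l′ f
  Σ-++ [] l′ f = sym (+-identityˡ _)
  Σ-++ (x ∷ l) l′ f = trans (+-congˡ (Σ-++ l l′ f)) (sym (+-assoc _ _ _))

  Σ-+ : ∀ (l : List A) f g → Σ l (λ x → f x + g x) ≈ Σ l f + Σ l g
  Σ-+ [] f g = sym (+-identityˡ _)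
  Σ-+ (x ∷ l) f g = begin
    (f x + g x) + Σ l (λ x → f x + g x) ≈⟨ +-congˡ (Σ-+ l f g) ⟩
    (f x + g x) + (Σ l f + Σ l g)       ≈⟨ +-assoc _ _ _ ⟩
    f x + (g x + (Σ l f + Σ l g))       ≈⟨ +-congˡ (x+[y+z]≈y+[x+z] _ _ _) ⟩
    f x + (Σ l f + (g x + Σ l g))       ≈⟨ +-assoc _ _ _ ⟨
    (f x + Σ l f) + (g x + Σ l g)       ∎

  Σ-*ˡ : ∀ (l : List A) k f → k * Σ l f ≈ Σ l (λ x → k * f x)
  Σ-*ˡ [] k f = zeroʳ k
  Σ-*ˡ (x ∷ l) k f = trans (distribˡ k _ _) (+-congˡ (Σ-*ˡ l k f))

  Σ-*ʳ : ∀ (l : List A) k f → Σ l f * k ≈ Σ l (λ x → f x * k)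
  Σ-*ʳ l k f = trans (*-comm _ _) (trans (Σ-*ˡ l k f) (Σ-cong l (λ x → *-comm _ _)))

  Σ-filter-split : ∀ {p} {P : A → Set p} (P? : Decidable P) (l : List A) f →
    Σ l f ≈ Σ (filter P? l) f + Σ (filter (¬? ∘ P?) l) f
  Σ-filter-split P? [] f = sym (+-identityˡ _)
  Σ-filter-split P? (x ∷ l) f with P? x
  ... | yes _ = trans (+-congˡ (Σ-filter-split P? l f)) (sym (+-assoc _ _ _))
  ... | no _ = trans (+-congˡ (Σ-filter-split P? l f)) (x+[y+z]≈y+[x+z] _ _ _)

  Σ-upTo-suc : ∀ t (h : ℕ → C) → Σ (upTo (suc t)) h ≈ h 0 + Σ (upTo t) (h ∘ suc)
  Σ-upTo-suc t h = +-congˡ (reflexive (≡.trans (≡.cong (λ l → Σ l h) (≡.sym (map-upTo suc t))) (Σ-map suc (upTo t) h)))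

  Σ-upTo-const : ∀ t k → Σ (upTo t) (λ _ → k) ≈ t × k
  Σ-upTo-const zero k = refl
  Σ-upTo-const (suc t) k = trans (Σ-upTo-suc t (λ _ → k)) (+-congˡ (Σ-upTo-const t k))

  module _ {B : Set b} (_≟_ : DecidableEquality B) (key : A → B) (F : A → C) where

    fibre : B → List A → List A
    fibre d = filter (λ k → key k ≟ d)

    Σ-partition : ∀ (D : List B) → Unique D → ∀ (L : List A) → (∀ {k} → k ∈ L → key k ∈ D) →
      Σ L F ≈ Σ D (λ d → Σ (fibre d L) F)
    Σ-partition D u [] _ = sym (Σ-zero D)
    Σ-partition D u (k ∷ L) key∈D = begin
      F k + Σ L F                                                ≈⟨ +-cong (sym (single D u (key∈D (here ≡.refl)))) (Σ-partition D u L (key∈D ∘ there)) ⟩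
      Σ D (λ d → Σ (fibre d [ k ]) F) + Σ D (λ d → Σ (fibre d L) F) ≈⟨ sym (Σ-+ D _ _) ⟩
      Σ D (λ d → Σ (fibre d [ k ]) F + Σ (fibre d L) F)           ≈⟨ Σ-cong D (λ d → sym (Σ-++ (fibre d [ k ]) (fibre d L) F)) ⟩
      Σ D (λ d → Σ (fibre d [ k ] ++ fibre d L) F)               ≈⟨ Σ-cong D (λ d → reflexive (≡.cong (λ l → Σ l F) (≡.sym (filter-++ (λ k → key k ≟ d) [ k ] L)))) ⟩
      Σ D (λ d → Σ (fibre d (k ∷ L)) F)                          ∎
      where
      single : ∀ (D : List B) → Unique D → key k ∈ D → Σ D (λ d → Σ (fibre d [ k ]) F) ≈ F k
      single (d ∷ D) (d∉D ∷ u) (here k↦d) with key k ≟ d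
      ... | no k↦̸d = ⊥-elim (k↦̸d k↦d)
      ... | yes _ = trans (+-congˡ (trans (Σ-cong∈ D absent) (Σ-zero D))) (trans (+-identityʳ _) (+-identityʳ _))
        where
        absent : ∀ {d′} → d′ ∈ D → Σ (fibre d′ [ k ]) F ≈ 0#
        absent {d′} d′∈D with key k ≟ d′
        ... | yes k↦d′ = ⊥-elim (All.lookup d∉D d′∈D (≡.trans (≡.sym k↦d) k↦d′))
        ... | no _ = refl
      single (d ∷ D) (d∉D ∷ u) (there k↦D) with key k ≟ d
      ... | yes k↦d = ⊥-elim (All.lookup d∉D k↦D (≡.sym k↦d))
      ... | no _ = trans (+-identityˡ _) (single D u k↦D)

  Σ-upTo-+-last : ∀ t (b : ℕ → C) → Σ (upTo t) b + b t ≈ b 0 + Σ (map (1 ℕ.+_) (upTo t)) b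
  Σ-upTo-+-last t b = begin
    Σ (upTo t) b + b t             ≈⟨ +-congˡ (+-identityʳ (b t)) ⟨
    Σ (upTo t) b + Σ [ t ] b       ≈⟨ Σ-++ (upTo t) [ t ] b ⟨
    Σ (upTo t ++ [ t ]) b          ≡⟨ ≡.cong (λ l → Σ l b) (upTo-∷ʳ t) ⟩
    Σ (upTo (suc t)) b             ≈⟨ Σ-upTo-suc t b ⟩
    b 0 + Σ (upTo t) (b ∘ suc)     ≡⟨ ≡.cong (b 0 +_) (Σ-map suc (upTo t) b) ⟨
    b 0 + Σ (map suc (upTo t)) b   ∎

module ResidueBlocks {c ℓ} (S : CommutativeSemiring c ℓ) where

  open ListLemmas
  open Arithmetic
  open Sums S
  open import Data.Nat as ℕ using (ℕ; zero; suc; _+_; _*_)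
  open import Data.Nat.Properties using (+-assoc)
  open import Data.Nat.Divisibility using (_∣_; _∣?_)
  open import Data.Nat.Primality using (Prime)
  open import Data.List using (List; _++_; map; filter; upTo)
  open import Data.List.Properties using (filter-++; filter-≐)
  open import Relation.Nullary using (¬_; ¬?)
  open import Function using (_∘_)
  import Relation.Binary.PropositionalEquality as ≡
  open CommutativeSemiring S using (_≈_; setoid; refl; reflexive; +-comm; +-congˡ) renaming (Carrier to C; _+_ to _⊕_)
  open import Relation.Binary.Reasoning.Setoid setoid

  Σblocks : ℕ → ℕ → (ℕ → C) → C
  Σblocks t m f = Σ (upTo t) (λ s → Σ (coprimes m) (λ u → f (s * m + u)))

  Σ-coprime-range : ∀ m t (f : ℕ → C) → Σ (filter (coprime? m) (range 1 (t * m))) f ≈ Σblocks t m f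
  Σ-coprime-range m zero f = refl
  Σ-coprime-range m (suc t) f = begin
    Σ (filter (coprime? m) (range 1 (m + t * m))) f
      ≡⟨ ≡.cong (λ l → Σ (filter (coprime? m) l) f) (range1-+ m (t * m)) ⟩
    Σ (filter (coprime? m) (range 1 m ++ map (m +_) L)) f
      ≡⟨ ≡.cong (λ l → Σ l f) (filter-++ (coprime? m) (range 1 m) _) ⟩
    Σ (coprimes m ++ filter (coprime? m) (map (m +_) L)) f
      ≈⟨ Σ-++ (coprimes m) _ f ⟩
    Σ (coprimes m) f ⊕ Σ (filter (coprime? m) (map (m +_) L)) f
      ≡⟨ ≡.cong (λ l → Σ (coprimes m) f ⊕ Σ l f) (≡.trans (filter-map (coprime? m) (m +_) L) (≡.cong (map (m +_)) shift)) ⟩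
    Σ (coprimes m) f ⊕ Σ (map (m +_) (filter (coprime? m) L)) f
      ≡⟨ ≡.cong (Σ (coprimes m) f ⊕_) (Σ-map (m +_) (filter (coprime? m) L) f) ⟩
    Σ (coprimes m) f ⊕ Σ (filter (coprime? m) L) (f ∘ (m +_))
      ≈⟨ +-congˡ (Σ-coprime-range m t (f ∘ (m +_))) ⟩
    Σ (coprimes m) f ⊕ Σblocks t m (f ∘ (m +_))
      ≈⟨ +-congˡ (Σ-cong (upTo t) (λ s → Σ-cong (coprimes m) (λ u → reflexive (≡.cong f (≡.sym (+-assoc m (s * m) u)))))) ⟩
    Σ (coprimes m) f ⊕ Σ (upTo t) (λ s → Σ (coprimes m) (λ u → f (suc s * m + u)))
      ≈⟨ Σ-upTo-suc t (λ s → Σ (coprimes m) (λ u → f (s * m + u))) ⟨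
    Σblocks (suc t) m f ∎
    where
    L : List ℕ
    L = range 1 (t * m)
    shift : filter (coprime? m ∘ (m +_)) L ≡.≡ filter (coprime? m) L
    shift = filter-≐ (coprime? m ∘ (m +_)) (coprime? m) (⇔⇒≐ (gcd[m+x,m]≡1⇔gcd[x,m]≡1 m)) L

  Σ-coprimes-*-∣ : ∀ p m → p ∣ m → (f : ℕ → C) → Σ (coprimes (p * m)) f ≈ Σblocks p m f
  Σ-coprimes-*-∣ p m p∣m f = begin
    Σ (coprimes (p * m)) f
      ≡⟨ ≡.cong (λ l → Σ l f) (filter-≐ (coprime? (p * m)) (coprime? m) (⇔⇒≐ (λ j → gcd[j,p*m]≡1⇔gcd[j,m]≡1 j p∣m)) (range 1 (p * m))) ⟩
    Σ (filter (coprime? m) (range 1 (p * m))) f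
      ≈⟨ Σ-coprime-range m p f ⟩
    Σblocks p m f ∎

  -- The residues below p·m coprime to m are those coprime to p·m together with the p·u, u ∈ coprimes m.
  Σ-coprimes-*-∤ : ∀ p m → Prime p → ¬ p ∣ m → (f : ℕ → C) →
    Σ (coprimes (p * m)) f ⊕ Σ (coprimes m) (λ u → f (p * u)) ≈ Σblocks p m f
  Σ-coprimes-*-∤ p m pp p∤m f = begin
    Σ (coprimes (p * m)) f ⊕ Σ (coprimes m) (λ u → f (p * u))             ≈⟨ +-comm _ _ ⟩
    Σ (coprimes m) (λ u → f (p * u)) ⊕ Σ (coprimes (p * m)) f             ≡⟨ ≡.cong₂ _⊕_ (≡.sym multiples) (≡.sym nonMultiples) ⟩
    Σ (filter (p ∣?_) L) f ⊕ Σ (filter (¬? ∘ (p ∣?_)) L) f               ≈⟨ Σ-filter-split (p ∣?_) L f ⟨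
    Σ L f                                                               ≈⟨ Σ-coprime-range m p f ⟩
    Σblocks p m f ∎
    where
    L : List ℕ
    L = filter (coprime? m) (range 1 (p * m))
    multiples : Σ (filter (p ∣?_) L) f ≡.≡ Σ (coprimes m) (λ u → f (p * u))
    multiples = ≡.trans (≡.cong (λ l → Σ l f) (filter-∣-coprimes pp p∤m)) (Σ-map (p *_) (coprimes m) f)
    nonMultiples : Σ (filter (¬? ∘ (p ∣?_)) L) f ≡.≡ Σ (coprimes (p * m)) f
    nonMultiples = ≡.cong (λ l → Σ l f) (filter-∤-coprimes pp p∤m)

module Totient where

  open Arithmetic
  open import Data.Nat as ℕ using (ℕ; zero; suc; _+_; _*_; _≤_; z≤n; s≤s)
  open import Data.Nat.Properties using (+-*-commutativeSemiring)
  open import Data.Nat.GCD using (gcd-zeroˡ)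
  open import Data.Nat.Divisibility using (_∣_)
  open import Data.Nat.Primality using (Prime)
  open import Data.List using (List; []; _∷_; map; filter; length)
  open import Data.List.Properties using (filter-accept)
  open import Relation.Nullary using (¬_)
  open import Relation.Binary.PropositionalEquality
  open import Algebra.Bundles using (CommutativeSemiring)
  open import Algebra.Definitions.RawSemiring (CommutativeSemiring.rawSemiring +-*-commutativeSemiring) using (_×_)
  open Sums +-*-commutativeSemiring using (Σ; Σ-upTo-const)
  open ResidueBlocks +-*-commutativeSemiring using (Σblocks; Σ-coprimes-*-∣; Σ-coprimes-*-∤)
  open ≡-Reasoning

  φ≡Σ1 : ∀ n → φ n ≡ Σ (coprimes n) (λ _ → 1)
  φ≡Σ1 n = length≡Σ1 (coprimes n)
    where
    length≡Σ1 : (l : List ℕ) → length l ≡ Σ l (λ _ → 1)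
    length≡Σ1 [] = refl
    length≡Σ1 (x ∷ l) = cong suc (length≡Σ1 l)

  Σblocks-1 : ∀ p m → Σblocks p m (λ _ → 1) ≡ p * φ m
  Σblocks-1 p m = begin
    Σblocks p m (λ _ → 1)                ≡⟨ Σ-upTo-const p _ ⟩
    p × Σ (coprimes m) (λ _ → 1)         ≡⟨ ×≡* p _ ⟩
    p * Σ (coprimes m) (λ _ → 1)         ≡⟨ cong (p *_) (φ≡Σ1 m) ⟨
    p * φ m                              ∎
    where
    ×≡* : ∀ p x → p × x ≡ p * x
    ×≡* zero x = refl
    ×≡* (suc p) x = cong (x +_) (×≡* p x)

  φ-*-∣ : ∀ p m → p ∣ m → φ (p * m) ≡ p * φ m
  φ-*-∣ p m p∣m = trans (φ≡Σ1 (p * m)) (trans (Σ-coprimes-*-∣ p m p∣m _) (Σblocks-1 p m))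

  φ-*-∤ : ∀ p m → Prime p → ¬ p ∣ m → φ (p * m) + φ m ≡ p * φ m
  φ-*-∤ p m pp p∤m = begin
    φ (p * m) + φ m                                         ≡⟨ cong₂ _+_ (φ≡Σ1 (p * m)) (φ≡Σ1 m) ⟩
    Σ (coprimes (p * m)) (λ _ → 1) + Σ (coprimes m) (λ _ → 1) ≡⟨ Σ-coprimes-*-∤ p m pp p∤m _ ⟩
    Σblocks p m (λ _ → 1)                                   ≡⟨ Σblocks-1 p m ⟩
    p * φ m                                                 ∎

  φ-positive : ∀ n → 1 ≤ n → 1 ≤ φ n
  φ-positive (suc n) _ = subst (1 ≤_) (cong length (sym coprimes-suc)) (s≤s z≤n)
    where
    coprimes-suc : coprimes (suc n) ≡ 1 ∷ filter (coprime? (suc n)) (map suc (range 1 n))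
    coprimes-suc = trans (cong (filter (coprime? (suc n))) (ListLemmas.range1-suc n))
      (filter-accept (coprime? (suc n)) (gcd-zeroˡ (suc n)))

module Möbius where

  open ListLemmas
  open Arithmetic using (prime⇒≥2; coprime-*ʳ; prime∤⇒coprime)
  open import Data.Nat as ℕ using (ℕ; zero; suc; _+_; _*_; _∸_; _≤_; _<_; z≤n; s≤s)
  open import Data.Nat.Properties
  open import Data.Nat.Divisibility
  open import Data.Nat.Coprimality as Coprime using (coprime-divisor)
  open import Data.Nat.Primality
  open import Data.Integer as ℤ using (ℤ)
  open import Data.Integer.Properties using (-1*i≡-i)
  open import Data.Bool using (Bool; true; false; T)
  open import Data.List using (List; _++_; []; filter; applyUpTo; length)
  open import Data.List.Properties using (map-upTo; filter-++; filter-accept; filter-reject; ++-identityʳ)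
  open import Data.List.Relation.Unary.Any using (Any)
  open import Data.List.Relation.Unary.Any.Properties using (any⁺; any⁻; applyUpTo⁺; applyUpTo⁻)
  open import Relation.Nullary using (¬_)
  open import Relation.Nullary.Decidable using (⌊_⌋; toWitness; fromWitness; _×-dec_)
  open import Relation.Unary using (Decidable)
  open import Data.Product using (_×_; _,_; ∃-syntax)
  open import Data.Sum using (_⊎_; inj₁; inj₂)
  open import Data.Empty using (⊥-elim)
  open import Function using (_∘_; _⇔_; Equivalence; mk⇔)
  open import Function.Construct.Composition using (_⇔-∘_)
  open import Function.Construct.Symmetry using (⇔-sym)
  open import Relation.Binary.PropositionalEquality hiding ([_])
  open ≡-Reasoning

  range2≡applyUpTo : ∀ n → range 2 n ≡ applyUpTo (2 +_) (n ∸ 1)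
  range2≡applyUpTo n = map-upTo (2 +_) (n ∸ 1)

  T⇔T⇒≡ : ∀ {b b′} → T b ⇔ T b′ → b ≡ b′
  T⇔T⇒≡ {false} {false} _ = refl
  T⇔T⇒≡ {false} {true} e = ⊥-elim (Equivalence.from e _)
  T⇔T⇒≡ {true} {false} e = ⊥-elim (Equivalence.to e _)
  T⇔T⇒≡ {true} {true} _ = refl

  <∸1⇒≤ : ∀ {i n} → i < n ∸ 1 → 2 + i ≤ n
  <∸1⇒≤ {n = suc n} i< = s≤s i<

  ≤⇒<∸1 : ∀ {i n} → 2 + i ≤ n → i < n ∸ 1
  ≤⇒<∸1 {n = suc n} (s≤s h) = h

  Squareful : ℕ → Set
  Squareful n = ∃[ a ] (2 ≤ a × a ≤ n × a * a ∣ n)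

  T-squarefulB⇔Squareful : ∀ n → T (squarefulB n) ⇔ Squareful n
  T-squarefulB⇔Squareful n = mk⇔ to from
    where
    f : ℕ → Bool
    f m = ⌊ (m * m) ∣? n ⌋
    to : T (squarefulB n) → Squareful n
    to t with applyUpTo⁻ (2 +_) (subst (Any (T ∘ f)) (range2≡applyUpTo n) (any⁻ f (range 2 n) t))
    ... | i , i<n∸1 , aa∣n = 2 + i , s≤s (s≤s z≤n) , <∸1⇒≤ i<n∸1 , toWitness aa∣n
    from : Squareful n → T (squarefulB n)
    from (1 , s≤s () , _)
    from (suc (suc i) , _ , a≤n , aa∣n) = any⁺ f (subst (Any (T ∘ f)) (sym (range2≡applyUpTo n))
      (applyUpTo⁺ (2 +_) (fromWitness aa∣n) (≤⇒<∸1 a≤n)))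

  Squareful-*-∤ : ∀ {p m} → Prime p → ¬ p ∣ m → 1 ≤ m → Squareful (p * m) ⇔ Squareful m
  Squareful-*-∤ {p} {m} pp p∤m m≥1 = mk⇔ to from
    where
    instance _ = prime⇒nonZero pp
    to : Squareful (p * m) → Squareful m
    to (a , 2≤a , _ , aa∣pm) = a , 2≤a , a≤m , aa∣m
      where
      p∤a : ¬ p ∣ a
      p∤a p∣a = p∤m (*-cancelˡ-∣ p (∣-trans (*-pres-∣ p∣a p∣a) aa∣pm))
      aa∣m : a * a ∣ m
      aa∣m = coprime-divisor (Coprime.sym (coprime-*ʳ (prime∤⇒coprime pp p∤a) (prime∤⇒coprime pp p∤a))) aa∣pm
      a≤m : a ≤ m
      a≤m = ≤-trans (m≤m*n a a {{ℕ.>-nonZero (≤-trans (s≤s z≤n) 2≤a)}}) (∣⇒≤ {{ℕ.>-nonZero m≥1}} aa∣m)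
    from : Squareful m → Squareful (p * m)
    from (a , 2≤a , a≤m , aa∣m) = a , 2≤a , ≤-trans a≤m (m≤n*m m p) , ∣-trans aa∣m (n∣m*n p)

  primeDivisor? : (n : ℕ) → Decidable (λ q → Prime q × q ∣ n)
  primeDivisor? n q = prime? q ×-dec (q ∣? n)

  numPrimeDivisors-applyUpTo : ∀ n t → length (filter (primeDivisor? (suc n)) (applyUpTo (2 +_) (n + t))) ≡ numPrimeDivisors (suc n)
  numPrimeDivisors-applyUpTo n t = begin
    length (filter P? (applyUpTo (2 +_) (n + t)))                                        ≡⟨ cong (length ∘ filter P?) (applyUpTo-+ (2 +_) n t) ⟩
    length (filter P? (applyUpTo (2 +_) n ++ applyUpTo (λ x → 2 + (n + x)) t))          ≡⟨ cong length (filter-++ P? (applyUpTo (2 +_) n) _) ⟩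
    length (filter P? (applyUpTo (2 +_) n) ++ filter P? (applyUpTo (λ x → 2 + (n + x)) t)) ≡⟨ cong (λ l → length (filter P? (applyUpTo (2 +_) n) ++ l)) tooLarge ⟩
    length (filter P? (applyUpTo (2 +_) n) ++ [])                                        ≡⟨ cong length (++-identityʳ (filter P? (applyUpTo (2 +_) n))) ⟩
    length (filter P? (applyUpTo (2 +_) n))                                              ≡⟨ cong (length ∘ filter P?) (range2≡applyUpTo (suc n)) ⟨
    numPrimeDivisors (suc n)                                                             ∎
    where
    P? : Decidable (λ q → Prime q × q ∣ suc n)
    P? = primeDivisor? (suc n)
    tooLarge : filter P? (applyUpTo (λ x → 2 + (n + x)) t) ≡ []
    tooLarge = filter-none-applyUpTo P? _ t (λ x _ (_ , d∣n) → <⇒≱ (s≤s (s≤s (m≤m+n n x))) (∣⇒≤ d∣n))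

  length-filter-≡-applyUpTo : ∀ v c a K → v ≡ c + a → a < K → length (filter (_≟ v) (applyUpTo (c +_) K)) ≡ 1
  length-filter-≡-applyUpTo v c zero (suc K) v≡c+0 _ = trans (cong length (filter-accept (_≟ v) (sym v≡c+0)))
    (cong suc (cong length (filter-none-applyUpTo (_≟ v) (λ x → c + suc x) K (λ x _ e → 1+n≢0 (+-cancelˡ-≡ c (suc x) 0 (trans e v≡c+0))))))
  length-filter-≡-applyUpTo v c (suc a) (suc K) v≡c+1+a (s≤s a<K) = begin
    length (filter (_≟ v) (applyUpTo (c +_) (suc K)))         ≡⟨ cong length (filter-reject (_≟ v) c+0≢v) ⟩
    length (filter (_≟ v) (applyUpTo (λ x → c + suc x) K))    ≡⟨ cong (length ∘ filter (_≟ v)) (applyUpTo-cong (+-suc c) K) ⟩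
    length (filter (_≟ v) (applyUpTo (suc c +_) K))           ≡⟨ length-filter-≡-applyUpTo v (suc c) a K (trans v≡c+1+a (+-suc c a)) a<K ⟩
    1                                                          ∎
    where
    c+0≢v : ¬ c + 0 ≡ v
    c+0≢v e = 1+n≢0 (sym (+-cancelˡ-≡ c 0 (suc a) (trans e v≡c+1+a)))

  numPrimeDivisors-*-∤ : ∀ p m → Prime p → ¬ p ∣ m → 1 ≤ m → numPrimeDivisors (p * m) ≡ suc (numPrimeDivisors m)
  numPrimeDivisors-*-∤ p@(suc (suc a)) m@(suc n) pp p∤m _ = begin
    numPrimeDivisors (p * m)                                    ≡⟨ cong (length ∘ filter (primeDivisor? (p * m))) (range2≡applyUpTo (p * m)) ⟩
    length (filter (primeDivisor? (p * m)) L)                   ≡⟨ length-filter-⊎ (primeDivisor? m) (_≟ p) (primeDivisor? (p * m)) split disjoint L ⟩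
    length (filter (primeDivisor? m) L) + length (filter (_≟ p) L) ≡⟨ cong₂ _+_ (numPrimeDivisors-applyUpTo n (suc a * m)) (length-filter-≡-applyUpTo p 2 a _ refl a<) ⟩
    numPrimeDivisors m + 1                                      ≡⟨ +-comm _ 1 ⟩
    suc (numPrimeDivisors m)                                    ∎
    where
    L : List ℕ
    L = applyUpTo (2 +_) (n + suc a * m)
    a< : a < n + suc a * m
    a< = ≤-trans (m≤m*n (suc a) m) (m≤n+m _ n)
    disjoint : ∀ q → ¬ ((Prime q × q ∣ m) × q ≡ p)
    disjoint q ((_ , q∣m) , refl) = p∤m q∣m
    split : ∀ q → (Prime q × q ∣ p * m) ⇔ ((Prime q × q ∣ m) ⊎ q ≡ p)
    split q = mk⇔ to from
      where
      to : Prime q × q ∣ p * m → (Prime q × q ∣ m) ⊎ q ≡ p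
      to (pq , q∣pm) with euclidsLemma p m pq q∣pm
      ... | inj₂ q∣m = inj₁ (pq , q∣m)
      ... | inj₁ q∣p with prime⇒irreducible pp q∣p
      ...   | inj₁ refl = ⊥-elim (¬prime[1] pq)
      ...   | inj₂ q≡p = inj₂ q≡p
      from : (Prime q × q ∣ m) ⊎ q ≡ p → Prime q × q ∣ p * m
      from (inj₁ (pq , q∣m)) = pq , ∣-trans q∣m (n∣m*n p)
      from (inj₂ refl) = pp , m∣m*n m

  μ-*-∤ : ∀ p m → Prime p → ¬ p ∣ m → 1 ≤ m → μ (p * m) ≡ ℤ.- μ m
  μ-*-∤ p m pp p∤m m≥1
    rewrite numPrimeDivisors-*-∤ p m pp p∤m m≥1
          | T⇔T⇒≡ {squarefulB (p * m)} {squarefulB m} (⇔-sym (T-squarefulB⇔Squareful m) ⇔-∘ (Squareful-*-∤ pp p∤m m≥1 ⇔-∘ T-squarefulB⇔Squareful (p * m)))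
    with squarefulB m
  ... | true = refl
  ... | false = -1*i≡-i _

  μ-*-∣ : ∀ p m → Prime p → p ∣ m → 1 ≤ m → μ (p * m) ≡ ℤ.+ 0
  μ-*-∣ p m pp p∣m m≥1
    rewrite T⇔T⇒≡ {squarefulB (p * m)} {true} (mk⇔ _ (λ _ → Equivalence.from (T-squarefulB⇔Squareful (p * m))
      (p , prime⇒≥2 pp , m≤m*n p m {{ℕ.>-nonZero m≥1}} , *-monoʳ-∣ p p∣m))) = refl

module RingFacts {a ℓ} (R : CommutativeRing a ℓ) where

  open import Data.Nat as ℕ using (ℕ; zero; suc)
  import Data.Nat.Properties as ℕ
  open import Data.Integer as ℤ using (ℤ; -[1+_])
  import Data.Integer.Properties as ℤ
  open import Relation.Binary.PropositionalEquality as ≡ using (_≡_)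
  open import Data.Sum using (inj₁; inj₂)
  open import Data.Empty using (⊥-elim)
  open CommutativeRing R
  open import Algebra.Definitions.RawSemiring (Semiring.rawSemiring semiring) using (_^_; _×_)
  open import Relation.Binary.Reasoning.Setoid setoid
  open import Algebra.Properties.Group (AbelianGroup.group +-abelianGroup) public
    using (∙-cancelʳ; x∙y⁻¹≈ε⇒x≈y) renaming (⁻¹-involutive to -‿involutive; ε⁻¹≈ε to -0#≈0#; inverseˡ-unique to +≈0⇒≈-)
  open import Algebra.Properties.AbelianGroup +-abelianGroup using (⁻¹-∙-comm)
  open import Algebra.Properties.Monoid.Mult +-monoid public using (×-homo-+; ×-assocˡ; ×-congʳ)
  open import Algebra.Properties.CommutativeMonoid.Mult +-commutativeMonoid public using (×-distrib-+)
  open import Algebra.Properties.Semiring.Mult semiring public using (×-assoc-*)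
  open import Algebra.Properties.Semiring.Exp semiring public using (^-homo-*; ^-assocʳ; ^-congˡ)
  open import Algebra.Properties.Ring ring public using (-1*x≈-x)

  ×-zeroʳ : ∀ n → n × 0# ≈ 0#
  ×-zeroʳ zero = refl
  ×-zeroʳ (suc n) = trans (+-identityˡ _) (×-zeroʳ n)

  ×-‿distrib : ∀ n x → n × (- x) ≈ - (n × x)
  ×-‿distrib zero x = sym -0#≈0#
  ×-‿distrib (suc n) x = trans (+-congˡ (×-‿distrib n x)) (⁻¹-∙-comm x (n × x))

  ×1-* : ∀ n x → (n × 1#) * x ≈ n × x
  ×1-* n x = trans (×-assoc-* n 1# x) (×-congʳ n (*-identityˡ x))

  ×-comm-× : ∀ m n x → m × (n × x) ≈ n × (m × x)
  ×-comm-× m n x = trans (×-assocˡ x m n) (trans (reflexive (≡.cong (_× x) (ℕ.*-comm m n))) (sym (×-assocˡ x n m)))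

  1^n≈1 : ∀ n → 1# ^ n ≈ 1#
  1^n≈1 zero = refl
  1^n≈1 (suc n) = trans (*-identityˡ _) (1^n≈1 n)

  ℤ→R-neg : ∀ z → ℤ→R R (ℤ.- z) ≈ - ℤ→R R z
  ℤ→R-neg (ℤ.+ zero) = sym -0#≈0#
  ℤ→R-neg (ℤ.+ suc n) = refl
  ℤ→R-neg -[1+ n ] = sym (-‿involutive _)

  ℤ→R-× : ∀ n z → n × ℤ→R R z ≈ ℤ→R R (ℤ.+ n ℤ.* z)
  ℤ→R-× n (ℤ.+ b) = trans (×-assocˡ 1# n b) (reflexive (≡.cong (ℤ→R R) (ℤ.pos-* n b)))
  ℤ→R-× n -[1+ b ] = begin
    n × (- (suc b × 1#))                ≈⟨ ×-‿distrib n _ ⟩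
    - (n × (suc b × 1#))                ≈⟨ -‿cong (×-assocˡ 1# n (suc b)) ⟩
    - ℤ→R R (ℤ.+ (n ℕ.* suc b))         ≈⟨ ℤ→R-neg (ℤ.+ (n ℕ.* suc b)) ⟨
    ℤ→R R (ℤ.- (ℤ.+ (n ℕ.* suc b)))     ≡⟨ ≡.cong (λ w → ℤ→R R (ℤ.- w)) (ℤ.pos-* n (suc b)) ⟩
    ℤ→R R (ℤ.- (ℤ.+ n ℤ.* ℤ.+ suc b))   ≡⟨ ≡.cong (ℤ→R R) (ℤ.neg-distribʳ-* (ℤ.+ n) (ℤ.+ suc b)) ⟩
    ℤ→R R (ℤ.+ n ℤ.* -[1+ b ])          ∎

  module _ (charZero : HasCharZero R) where

    private
      ×1-injective-≤ : ∀ m n → m ℕ.≤ n → m × 1# ≈ n × 1# → m ≡ n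
      ×1-injective-≤ m n m≤n e = ≡.trans (≡.sym (ℕ.+-identityʳ m)) (≡.trans (≡.cong (m ℕ.+_) (≡.sym n∸m≡0)) (ℕ.m+[n∸m]≡n m≤n))
        where
        n∸m≡0 : n ℕ.∸ m ≡ 0
        n∸m≡0 = charZero (n ℕ.∸ m) (∙-cancelʳ _ _ _ (begin
          (n ℕ.∸ m) × 1# + m × 1#   ≈⟨ +-comm _ _ ⟩
          m × 1# + (n ℕ.∸ m) × 1#   ≈⟨ ×-homo-+ 1# m (n ℕ.∸ m) ⟨
          (m ℕ.+ (n ℕ.∸ m)) × 1#    ≡⟨ ≡.cong (_× 1#) (ℕ.m+[n∸m]≡n m≤n) ⟩
          n × 1#                    ≈⟨ e ⟨
          m × 1#                    ≈⟨ +-identityˡ _ ⟨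
          0# + m × 1#               ∎))

    ×1-injective : ∀ m n → m × 1# ≈ n × 1# → m ≡ n
    ×1-injective m n e with ℕ.≤-total m n
    ... | inj₁ m≤n = ×1-injective-≤ m n m≤n e
    ... | inj₂ n≤m = ≡.sym (×1-injective-≤ n m n≤m (sym e))

    ℤ→R-injective : ∀ x y → ℤ→R R x ≈ ℤ→R R y → x ≡ y
    ℤ→R-injective (ℤ.+ m) (ℤ.+ n) e = ≡.cong ℤ.+_ (×1-injective m n e)
    ℤ→R-injective (ℤ.+ m) -[1+ n ] e = ⊥-elim (ℕ.m+1+n≢0 m (charZero (m ℕ.+ suc n) (trans (×-homo-+ 1# m (suc n)) (trans (+-congʳ e) (-‿inverseˡ _)))))
    ℤ→R-injective -[1+ m ] (ℤ.+ n) e = ⊥-elim (ℕ.m+1+n≢0 n (charZero (n ℕ.+ suc m) (trans (×-homo-+ 1# n (suc m)) (trans (+-congʳ (sym e)) (-‿inverseˡ _)))))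
    ℤ→R-injective -[1+ m ] -[1+ n ] e = ≡.cong -[1+_] (ℕ.suc-injective (×1-injective (suc m) (suc n)
      (trans (sym (-‿involutive _)) (trans (-‿cong e) (-‿involutive _)))))

module RootsOfUnity {a ℓ} (R : CommutativeRing a ℓ) (domain : IsIntegralDomain R) where

  open import Data.Nat as ℕ using (ℕ; zero; suc; _≤_; _<_; z≤n; s≤s)
  import Data.Nat.Properties as ℕ
  open import Data.Nat.DivMod using (_%_; _/_; m≡m%n+[m/n]*n; m%n<n)
  open import Data.Nat.Divisibility using (_∣_; divides; m%n≡0⇒n∣m; n∣m*n)
  open import Relation.Binary.PropositionalEquality as ≡ using (_≡_)
  open import Data.Product using (_,_)
  open import Data.Sum using (inj₁; inj₂)
  open import Relation.Nullary using (¬_)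
  open import Data.Empty using (⊥-elim)
  open import Data.List using (upTo)
  open CommutativeRing R
  open import Algebra.Definitions.RawSemiring (Semiring.rawSemiring semiring) using (_^_; _×_)
  open import Relation.Binary.Reasoning.Setoid setoid
  open RingFacts R
  open Sums commutativeSemiring

  ^-∣ : ∀ {m η} → η ^ m ≈ 1# → ∀ {x} → m ∣ x → η ^ x ≈ 1#
  ^-∣ {m} {η} ηᵐ≈1 (divides q ≡.refl) = begin
    η ^ (q ℕ.* m) ≡⟨ ≡.cong (η ^_) (ℕ.*-comm q m) ⟩
    η ^ (m ℕ.* q) ≈⟨ ^-assocʳ η m q ⟨
    (η ^ m) ^ q   ≈⟨ ^-congˡ q ηᵐ≈1 ⟩
    1# ^ q        ≈⟨ 1^n≈1 q ⟩
    1#            ∎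

  primitive-^≈1⇒∣ : ∀ {m η} → IsPrimitiveRoot R m η → 1 ≤ m → ∀ x → η ^ x ≈ 1# → m ∣ x
  primitive-^≈1⇒∣ {suc m} {η} (ηᵐ≈1 , minimal) _ x ηˣ≈1 with x % suc m in x%m≡r
  ... | zero = m%n≡0⇒n∣m x (suc m) x%m≡r
  ... | suc r = ⊥-elim (minimal (suc r) (s≤s z≤n) (≡.subst (_< suc m) x%m≡r (m%n<n x (suc m))) ηʳ≈1)
    where
    ηʳ≈1 : η ^ suc r ≈ 1#
    ηʳ≈1 = begin
      η ^ suc r                                      ≈⟨ *-identityʳ _ ⟨
      η ^ suc r * 1#                                 ≈⟨ *-congˡ (^-∣ ηᵐ≈1 (n∣m*n (x / suc m))) ⟨
      η ^ suc r * η ^ ((x / suc m) ℕ.* suc m)        ≈⟨ ^-homo-* η (suc r) _ ⟨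
      η ^ (suc r ℕ.+ (x / suc m) ℕ.* suc m)          ≡⟨ ≡.cong (λ z → η ^ (z ℕ.+ (x / suc m) ℕ.* suc m)) x%m≡r ⟨
      η ^ (x % suc m ℕ.+ (x / suc m) ℕ.* suc m)      ≡⟨ ≡.cong (η ^_) (m≡m%n+[m/n]*n x (suc m)) ⟨
      η ^ x                                          ≈⟨ ηˣ≈1 ⟩
      1#                                             ∎

  primitive-^ : ∀ {p m η} → 1 ≤ p → IsPrimitiveRoot R (p ℕ.* m) η → IsPrimitiveRoot R m (η ^ p)
  primitive-^ {p} {m} {η} p≥1 (ηᵖᵐ≈1 , minimal) = trans (^-assocʳ η p m) ηᵖᵐ≈1 ,
    λ j j≥1 j<m ηᵖʲ≈1 → minimal (p ℕ.* j) (ℕ.*-mono-≤ p≥1 j≥1) (ℕ.*-monoʳ-< p {{ℕ.>-nonZero p≥1}} j<m) (trans (sym (^-assocʳ η p j)) ηᵖʲ≈1)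

  geometric : Carrier → ℕ → Carrier
  geometric ω t = Σ (upTo t) (ω ^_)

  geometric-shift : ∀ ω t → ω * geometric ω t + 1# ≈ geometric ω t + ω ^ t
  geometric-shift ω zero = +-congʳ (zeroʳ ω)
  geometric-shift ω (suc t) = begin
    ω * G[t+1] + 1#                        ≈⟨ +-congʳ (*-congˡ unfold) ⟩
    ω * (1# + ω * G[t]) + 1#               ≈⟨ +-congʳ (distribˡ ω 1# _) ⟩
    (ω * 1# + ω * (ω * G[t])) + 1#         ≈⟨ +-congʳ (+-comm _ _) ⟩
    (ω * (ω * G[t]) + ω * 1#) + 1#         ≈⟨ +-congʳ (distribˡ ω _ 1#) ⟨
    ω * (ω * G[t] + 1#) + 1#               ≈⟨ +-congʳ (*-congˡ (geometric-shift ω t)) ⟩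
    ω * (G[t] + ω ^ t) + 1#                ≈⟨ +-congʳ (distribˡ ω _ _) ⟩
    (ω * G[t] + ω ^ suc t) + 1#            ≈⟨ +-comm _ _ ⟩
    1# + (ω * G[t] + ω ^ suc t)            ≈⟨ +-assoc _ _ _ ⟨
    (1# + ω * G[t]) + ω ^ suc t            ≈⟨ +-congʳ unfold ⟨
    G[t+1] + ω ^ suc t                     ∎
    where
    G[t] G[t+1] : Carrier
    G[t] = geometric ω t
    G[t+1] = geometric ω (suc t)
    unfold : G[t+1] ≈ 1# + ω * G[t]
    unfold = trans (Σ-upTo-suc t (ω ^_)) (+-congˡ (sym (Σ-*ˡ (upTo t) ω (ω ^_))))

  geometric-root : ∀ ω t → ω ^ t ≈ 1# → ¬ ω ≈ 1# → geometric ω t ≈ 0#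
  geometric-root ω t ωᵗ≈1 ω≉1 with domain (ω - 1#) (geometric ω t) [ω-1]G≈0
    where
    ωG≈G : ω * geometric ω t ≈ geometric ω t
    ωG≈G = ∙-cancelʳ 1# _ _ (trans (geometric-shift ω t) (+-congˡ ωᵗ≈1))
    [ω-1]G≈0 : (ω - 1#) * geometric ω t ≈ 0#
    [ω-1]G≈0 = begin
      (ω - 1#) * geometric ω t                          ≈⟨ distribʳ _ ω (- 1#) ⟩
      ω * geometric ω t + (- 1#) * geometric ω t        ≈⟨ +-cong ωG≈G (-1*x≈-x _) ⟩
      geometric ω t - geometric ω t                     ≈⟨ -‿inverseʳ _ ⟩
      0#                                                ∎
  ... | inj₁ ω-1≈0 = ⊥-elim (ω≉1 (x∙y⁻¹≈ε⇒x≈y ω 1# ω-1≈0))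
  ... | inj₂ G≈0 = G≈0

  geometric-one : ∀ ω t → ω ≈ 1# → geometric ω t ≈ t × 1#
  geometric-one ω t ω≈1 = trans (Σ-cong (upTo t) (λ s → trans (^-congˡ s ω≈1) (1^n≈1 s))) (Σ-upTo-const t 1#)

module RamanujanRecurrences {a ℓ} (R : CommutativeRing a ℓ) (domain : IsIntegralDomain R) where

  open Arithmetic using (coprimes; prime⇒≥1)
  open import Data.Nat as ℕ using (ℕ; _≤_; _*_; _+_)
  import Data.Nat.Properties as ℕ
  open import Data.Nat.Divisibility using (_∣_; divides; *-cancelˡ-∣)
  open import Data.Nat.Primality using (Prime)
  open import Relation.Binary.PropositionalEquality as ≡ using (_≡_)
  open import Data.Product using (proj₁)
  open import Relation.Nullary using (¬_)
  open import Data.List using (upTo)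
  open CommutativeRing R using (Carrier; _≈_; 0#; 1#; setoid; sym; trans; reflexive; zeroˡ; +-congˡ; *-cong; *-congʳ) renaming (_+_ to _⊕_; _*_ to _⊗_)
  open import Algebra.Definitions.RawSemiring (Semiring.rawSemiring (CommutativeRing.semiring R)) using (_^_; _×_)
  open import Relation.Binary.Reasoning.Setoid setoid
  open RingFacts R using (^-homo-*; ^-assocʳ)
  open RootsOfUnity R domain
  open Sums (CommutativeRing.commutativeSemiring R)
  open ResidueBlocks (CommutativeRing.commutativeSemiring R) using (Σblocks; Σ-coprimes-*-∣; Σ-coprimes-*-∤)

  Σblocks-geometric : ∀ p m η k → Σblocks p m (λ j → η ^ (j * k)) ≈ geometric (η ^ (m * k)) p ⊗ ramSum R m η k
  Σblocks-geometric p m η k = begin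
    Σblocks p m (λ j → η ^ (j * k))                           ≈⟨ Σ-cong (upTo p) (λ s → Σ-cong (coprimes m) (λ u → split s u)) ⟩
    Σ (upTo p) (λ s → Σ (coprimes m) (λ u → ω ^ s ⊗ η ^ (u * k))) ≈⟨ Σ-cong (upTo p) (λ s → Σ-*ˡ (coprimes m) (ω ^ s) _) ⟨
    Σ (upTo p) (λ s → ω ^ s ⊗ ramSum R m η k)                   ≈⟨ Σ-*ʳ (upTo p) _ (ω ^_) ⟨
    geometric ω p ⊗ ramSum R m η k                             ∎
    where
    ω : Carrier
    ω = η ^ (m * k)
    split : ∀ s u → η ^ ((s * m + u) * k) ≈ ω ^ s ⊗ η ^ (u * k)
    split s u = begin
      η ^ ((s * m + u) * k)             ≡⟨ ≡.cong (η ^_) (ℕ.*-distribʳ-+ k (s * m) u) ⟩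
      η ^ (s * m * k + u * k)           ≡⟨ ≡.cong (λ e → η ^ (e + u * k)) (≡.trans (ℕ.*-assoc s m k) (ℕ.*-comm s (m * k))) ⟩
      η ^ (m * k * s + u * k)           ≈⟨ ^-homo-* η (m * k * s) (u * k) ⟩
      η ^ (m * k * s) ⊗ η ^ (u * k)     ≈⟨ *-congʳ (^-assocʳ η (m * k) s) ⟨
      ω ^ s ⊗ η ^ (u * k)               ∎

  ramSum-^ : ∀ p m η j → Σ (coprimes m) (λ u → η ^ ((p * u) * j)) ≈ ramSum R m (η ^ p) j
  ramSum-^ p m η j = Σ-cong (coprimes m) (λ u → trans (reflexive (≡.cong (η ^_) (ℕ.*-assoc p u j))) (sym (^-assocʳ η p (u * j))))

  module _ {p m : ℕ} {η : Carrier} (pp : Prime p) (m≥1 : 1 ≤ m) (ηprim : IsPrimitiveRoot R (p * m) η) where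

    private
      p≥1 : 1 ≤ p
      p≥1 = prime⇒≥1 pp

    Σblocks-∣ : ∀ q → Σblocks p m (λ j → η ^ (j * (q * p))) ≈ (p × 1#) ⊗ ramSum R m (η ^ p) q
    Σblocks-∣ q = trans (Σblocks-geometric p m η (q * p)) (*-cong (geometric-one _ p ωᵖ≈1) reindex)
      where
      ωᵖ≈1 : η ^ (m * (q * p)) ≈ 1#
      ωᵖ≈1 = ^-∣ (proj₁ ηprim) (divides q (≡.trans (≡.sym (ℕ.*-assoc m q p)) (≡.trans (ℕ.*-comm (m * q) p)
        (≡.trans (≡.sym (ℕ.*-assoc p m q)) (ℕ.*-comm (p * m) q)))))
      reindex : ramSum R m η (q * p) ≈ ramSum R m (η ^ p) q
      reindex = trans (Σ-cong (coprimes m) (λ u → reflexive (≡.cong (η ^_) (u*[q*p]≡p*u*q u)))) (ramSum-^ p m η q)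
        where
        u*[q*p]≡p*u*q : ∀ u → u * (q * p) ≡ (p * u) * q
        u*[q*p]≡p*u*q u = ≡.trans (≡.sym (ℕ.*-assoc u q p)) (≡.trans (ℕ.*-comm (u * q) p) (≡.sym (ℕ.*-assoc p u q)))

    -- For p ∤ k, ω = η^(mk) is a p-th root of unity different from 1 because η is primitive of order p·m.
    Σblocks-∤ : ∀ k → ¬ p ∣ k → Σblocks p m (λ j → η ^ (j * k)) ≈ 0#
    Σblocks-∤ k p∤k = trans (Σblocks-geometric p m η k) (trans (*-congʳ (geometric-root ω p ωᵖ≈1 ω≉1)) (zeroˡ _))
      where
      ω : Carrier
      ω = η ^ (m * k)
      ωᵖ≈1 : ω ^ p ≈ 1#
      ωᵖ≈1 = trans (^-assocʳ η (m * k) p) (^-∣ (proj₁ ηprim) (divides k (≡.trans (ℕ.*-assoc m k p)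
        (≡.trans (≡.cong (m *_) (ℕ.*-comm k p)) (≡.trans (≡.sym (ℕ.*-assoc m p k))
        (≡.trans (≡.cong (_* k) (ℕ.*-comm m p)) (ℕ.*-comm (p * m) k)))))))
      ω≉1 : ¬ ω ≈ 1#
      ω≉1 ω≈1 = p∤k (*-cancelˡ-∣ m {{ℕ.>-nonZero m≥1}} (≡.subst (_∣ m * k) (ℕ.*-comm p m)
        (primitive-^≈1⇒∣ ηprim (ℕ.*-mono-≤ p≥1 m≥1) _ ω≈1)))

    ramSum-*-∣-∣ : p ∣ m → ∀ q → ramSum R (p * m) η (q * p) ≈ (p × 1#) ⊗ ramSum R m (η ^ p) q
    ramSum-*-∣-∣ p∣m q = trans (Σ-coprimes-*-∣ p m p∣m _) (Σblocks-∣ q)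

    ramSum-*-∣-∤ : p ∣ m → ∀ k → ¬ p ∣ k → ramSum R (p * m) η k ≈ 0#
    ramSum-*-∣-∤ p∣m k p∤k = trans (Σ-coprimes-*-∣ p m p∣m _) (Σblocks-∤ k p∤k)

    ramSum-*-∤-∣ : ¬ p ∣ m → ∀ q → ramSum R (p * m) η (q * p) ⊕ ramSum R m (η ^ p) (q * p) ≈ (p × 1#) ⊗ ramSum R m (η ^ p) q
    ramSum-*-∤-∣ p∤m q = trans (+-congˡ (sym (ramSum-^ p m η (q * p)))) (trans (Σ-coprimes-*-∤ p m pp p∤m _) (Σblocks-∣ q))

    ramSum-*-∤-∤ : ¬ p ∣ m → ∀ k → ¬ p ∣ k → ramSum R (p * m) η k ⊕ ramSum R m (η ^ p) k ≈ 0#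
    ramSum-*-∤-∤ p∤m k p∤k = trans (+-congˡ (sym (ramSum-^ p m η k))) (trans (Σ-coprimes-*-∤ p m pp p∤m _) (Σblocks-∤ k p∤k))

module Hölder {a ℓ} (R : CommutativeRing a ℓ) (domain : IsIntegralDomain R) where

  open Arithmetic
  open Totient using (φ-*-∣; φ-*-∤)
  open Möbius using (μ-*-∤; μ-*-∣)
  open import Level using (_⊔_)
  open import Data.Nat as ℕ using (ℕ; suc; _≤_; _*_)
  import Data.Nat.Properties as ℕ
  open import Data.Nat.Divisibility using (_∣_; _∣?_; divides; ∣-trans; quotient; m∣n⇒n≡m*quotient; quotient-∣; m∣m*n)
  open import Data.Nat.GCD using (gcd; gcd[m,n]∣m; gcd[m,n]∣n; gcd-zeroʳ)
  open import Data.Nat.Primality using (Prime; euclidsLemma; productOfPrimes≥1)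
  open import Data.Nat.Primality.Factorisation using (factorise; PrimeFactorisation)
  open import Data.Integer as ℤ using (ℤ)
  open import Data.Nat.ListAction using (product)
  open import Data.List.Relation.Unary.All using (All; []; _∷_)
  open import Relation.Binary.PropositionalEquality as ≡ using (_≡_)
  open import Data.Product using (_,_)
  open import Data.Sum using (inj₁; inj₂)
  open import Relation.Nullary using (¬_; yes; no)
  open import Data.Empty using (⊥-elim)
  open CommutativeRing R renaming (_*_ to _⊗_)
  open import Algebra.Definitions.RawSemiring (Semiring.rawSemiring semiring) using (_^_; _×_)
  open import Relation.Binary.Reasoning.Setoid setoid
  open RingFacts R
  open RootsOfUnity R domain using (primitive-^)
  open RamanujanRecurrences R domain

  HölderFormula : ℕ → Set (a ⊔ ℓ)
  HölderFormula m = ∀ η → IsPrimitiveRoot R m η → ∀ k d → gcd k m ℕ.* d ≡ m → φ d × ramSum R m η k ≈ φ m × ℤ→R R (μ d)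

  hölder-1 : HölderFormula 1
  hölder-1 η (η¹≈1 , _) k d gd≡1 = begin
    φ d × (η ^ (1 * k) + 0#) ≡⟨ ≡.cong (λ d → φ d × (η ^ (1 * k) + 0#)) d≡1 ⟩
    η ^ (1 * k) + 0# + 0#    ≈⟨ trans (+-identityʳ _) (+-identityʳ _) ⟩
    η ^ (1 * k)              ≈⟨ ^-assocʳ η 1 k ⟨
    (η ^ 1) ^ k              ≈⟨ ^-congˡ k η¹≈1 ⟩
    1# ^ k                   ≈⟨ 1^n≈1 k ⟩
    1#                       ≈⟨ trans (+-identityʳ _) (+-identityʳ _) ⟨
    1 × (1 × 1#)             ≡⟨ ≡.cong (λ d → 1 × ℤ→R R (μ d)) d≡1 ⟨
    φ 1 × ℤ→R R (μ d)        ∎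
    where
    d≡1 : d ≡ 1
    d≡1 = ≡.trans (≡.sym (ℕ.+-identityʳ d)) (≡.subst (λ g → g * d ≡ 1) (gcd-zeroʳ k) gd≡1)

  module Step {p m : ℕ} (pp : Prime p) (m≥1 : 1 ≤ m) (IH : HölderFormula m)
              {η : Carrier} (ηprim : IsPrimitiveRoot R (p * m) η) where

    private
      p≥1 : 1 ≤ p
      p≥1 = prime⇒≥1 pp
      c c′ : ℕ → Carrier
      c = ramSum R (p * m) η
      c′ = ramSum R m (η ^ p)
      IH′ : ∀ k d → gcd k m * d ≡ m → φ d × c′ k ≈ φ m × ℤ→R R (μ d)
      IH′ = IH (η ^ p) (primitive-^ p≥1 ηprim)

    cofactor-* : ∀ q {d} → gcd (q * p) (p * m) * d ≡ p * m → gcd q m * d ≡ m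
    cofactor-* q {d} e = ℕ.*-cancelˡ-≡ _ _ p {{ℕ.>-nonZero p≥1}}
      (≡.trans (≡.sym (ℕ.*-assoc p (gcd q m) d)) (≡.trans (≡.cong (_* d) (≡.sym (gcd[q*p,p*m]≡p*gcd[q,m] p q m))) e))

    ×-lift : ∀ d y s → φ d × y ≈ φ m × s → φ d × ((p × 1#) ⊗ y) ≈ (p * φ m) × s
    ×-lift d y s e = begin
      φ d × ((p × 1#) ⊗ y) ≈⟨ ×-congʳ (φ d) (×1-* p y) ⟩
      φ d × (p × y)        ≈⟨ ×-comm-× (φ d) p y ⟩
      p × (φ d × y)        ≈⟨ ×-congʳ p e ⟩
      p × (φ m × s)        ≈⟨ ×-assocˡ s p (φ m) ⟩
      (p * φ m) × s        ∎

    cancel-φ : ∀ n → ¬ p ∣ n → ∀ {A} s → A + φ n × s ≈ (p * φ n) × s → A ≈ φ (p * n) × s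
    cancel-φ n p∤n {A} s e = ∙-cancelʳ (φ n × s) A (φ (p * n) × s) (begin
      A + φ n × s                ≈⟨ e ⟩
      (p * φ n) × s              ≡⟨ ≡.cong (_× s) (φ-*-∤ p n pp p∤n) ⟨
      (φ (p * n) ℕ.+ φ n) × s    ≈⟨ ×-homo-+ s (φ (p * n)) (φ n) ⟩
      φ (p * n) × s + φ n × s    ∎)

    p∣m-p∣k : p ∣ m → ∀ q d → gcd (q * p) (p * m) * d ≡ p * m → φ d × c (q * p) ≈ φ (p * m) × ℤ→R R (μ d)
    p∣m-p∣k p∣m q d e = begin
      φ d × c (q * p)                  ≈⟨ ×-congʳ (φ d) (ramSum-*-∣-∣ pp m≥1 ηprim p∣m q) ⟩
      φ d × ((p × 1#) ⊗ c′ q)          ≈⟨ ×-lift d (c′ q) _ (IH′ q d (cofactor-* q e)) ⟩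
      (p * φ m) × ℤ→R R (μ d)          ≡⟨ ≡.cong (_× ℤ→R R (μ d)) (φ-*-∣ p m p∣m) ⟨
      φ (p * m) × ℤ→R R (μ d)          ∎

    -- Here p ∤ gcd(k, pm), so p ∣ d and p ∣ d/p: μ(d) = 0 = c(k).
    p∣m-p∤k : p ∣ m → ∀ k → ¬ p ∣ k → ∀ d → gcd k (p * m) * d ≡ p * m → φ d × c k ≈ φ (p * m) × ℤ→R R (μ d)
    p∣m-p∤k p∣m k p∤k d e = begin
      φ d × c k                    ≈⟨ ×-congʳ (φ d) (ramSum-*-∣-∤ pp m≥1 ηprim p∣m k p∤k) ⟩
      φ d × 0#                     ≈⟨ ×-zeroʳ (φ d) ⟩
      0#                           ≈⟨ ×-zeroʳ (φ (p * m)) ⟨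
      φ (p * m) × ℤ→R R (ℤ.+ 0)    ≡⟨ ≡.cong (λ z → φ (p * m) × ℤ→R R z) (≡.trans (≡.cong μ d≡p*d′) (μ-*-∣ p d′ pp p∣d′ d′≥1)) ⟨
      φ (p * m) × ℤ→R R (μ d)      ∎
      where
      g : ℕ
      g = gcd k (p * m)
      p∤g : ¬ p ∣ g
      p∤g p∣g = p∤k (∣-trans p∣g (gcd[m,n]∣m k (p * m)))
      p∣d : p ∣ d
      p∣d with euclidsLemma g d pp (≡.subst (p ∣_) (≡.sym e) (m∣m*n m))
      ... | inj₁ p∣g = ⊥-elim (p∤g p∣g)
      ... | inj₂ p∣d = p∣d
      d′ : ℕ
      d′ = quotient p∣d
      d≡p*d′ : d ≡ p * d′
      d≡p*d′ = m∣n⇒n≡m*quotient p∣d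
      m≡g*d′ : m ≡ g * d′
      m≡g*d′ = ℕ.*-cancelˡ-≡ _ _ p {{ℕ.>-nonZero p≥1}} (≡.trans (≡.sym e) (≡.trans (≡.cong (g *_) d≡p*d′)
        (≡.trans (≡.sym (ℕ.*-assoc g p d′)) (≡.trans (≡.cong (_* d′) (ℕ.*-comm g p)) (ℕ.*-assoc p g d′)))))
      p∣d′ : p ∣ d′
      p∣d′ with euclidsLemma g d′ pp (≡.subst (p ∣_) m≡g*d′ p∣m)
      ... | inj₁ p∣g = ⊥-elim (p∤g p∣g)
      ... | inj₂ p∣d′ = p∣d′
      d′≥1 : 1 ≤ d′
      d′≥1 = factor-positiveʳ {g} (≡.sym m≡g*d′) m≥1

    p∤m-p∣k : ¬ p ∣ m → ∀ q d → gcd (q * p) (p * m) * d ≡ p * m → φ d × c (q * p) ≈ φ (p * m) × ℤ→R R (μ d)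
    p∤m-p∣k p∤m q d e = cancel-φ m p∤m s (begin
      φ d × c (q * p) + φ m × s                ≈⟨ +-congˡ (IH′ (q * p) d gcd[qp,m]*d≡m) ⟨
      φ d × c (q * p) + φ d × c′ (q * p)       ≈⟨ ×-distrib-+ _ _ (φ d) ⟨
      φ d × (c (q * p) + c′ (q * p))           ≈⟨ ×-congʳ (φ d) (ramSum-*-∤-∣ pp m≥1 ηprim p∤m q) ⟩
      φ d × ((p × 1#) ⊗ c′ q)                  ≈⟨ ×-lift d (c′ q) s (IH′ q d (cofactor-* q e)) ⟩
      (p * φ m) × s                            ∎)
      where
      s : Carrier
      s = ℤ→R R (μ d)
      gcd[qp,m]*d≡m : gcd (q * p) m * d ≡ m
      gcd[qp,m]*d≡m = ≡.subst (λ g → g * d ≡ m) (≡.sym gcd[qp,m]≡gcd[q,m]) (cofactor-* q e)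
        where
        open import Data.Nat.GCD using (gcd-comm)
        gcd[qp,m]≡gcd[q,m] : gcd (q * p) m ≡ gcd q m
        gcd[qp,m]≡gcd[q,m] = ≡.trans (gcd-comm (q * p) m) (≡.trans (≡.cong (gcd m) (ℕ.*-comm q p))
          (≡.trans (gcd[a,c*n]≡gcd[a,n] q (prime∤⇒coprime pp p∤m)) (gcd-comm m q)))

    -- Here d = p·d′ with d′ = m / gcd(k, m), and c(k) = -c′(k), μ(d) = -μ(d′).
    p∤m-p∤k : ¬ p ∣ m → ∀ k → ¬ p ∣ k → ∀ d → gcd k (p * m) * d ≡ p * m → φ d × c k ≈ φ (p * m) × ℤ→R R (μ d)
    p∤m-p∤k p∤m k p∤k d e = ≡.subst (λ d → φ d × c k ≈ φ (p * m) × ℤ→R R (μ d)) (≡.sym d≡p*d′) (begin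
      φ (p * d′) × c k              ≈⟨ ×-congʳ (φ (p * d′)) (+≈0⇒≈- _ _ (ramSum-*-∤-∤ pp m≥1 ηprim p∤m k p∤k)) ⟩
      φ (p * d′) × (- c′ k)          ≈⟨ ×-‿distrib (φ (p * d′)) _ ⟩
      - (φ (p * d′) × c′ k)          ≈⟨ -‿cong φpd′c′≈φpm·s ⟩
      - (φ (p * m) × s)              ≈⟨ ×-‿distrib (φ (p * m)) s ⟨
      φ (p * m) × (- s)              ≈⟨ ×-congʳ (φ (p * m)) (ℤ→R-neg (μ d′)) ⟨
      φ (p * m) × ℤ→R R (ℤ.- μ d′)   ≡⟨ ≡.cong (λ z → φ (p * m) × ℤ→R R z) (μ-*-∤ p d′ pp p∤d′ d′≥1) ⟨
      φ (p * m) × ℤ→R R (μ (p * d′)) ∎)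
      where
      g : ℕ
      g = gcd k m
      g≡ : gcd k (p * m) ≡ g
      g≡ = gcd[a,c*n]≡gcd[a,n] m (prime∤⇒coprime pp p∤k)
      g∣m : g ∣ m
      g∣m = gcd[m,n]∣n k m
      d′ : ℕ
      d′ = quotient g∣m
      g*d′≡m : g * d′ ≡ m
      g*d′≡m = ≡.sym (m∣n⇒n≡m*quotient g∣m)
      d′≥1 : 1 ≤ d′
      d′≥1 = factor-positiveʳ {g} g*d′≡m m≥1
      d≡p*d′ : d ≡ p * d′
      d≡p*d′ = ℕ.*-cancelˡ-≡ _ _ g {{ℕ.>-nonZero (factor-positiveˡ {g} g*d′≡m m≥1)}} (≡.trans (≡.cong (_* d) (≡.sym g≡))
        (≡.trans e (≡.trans (≡.cong (p *_) (≡.sym g*d′≡m)) (≡.trans (≡.sym (ℕ.*-assoc p g d′))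
        (≡.trans (≡.cong (_* d′) (ℕ.*-comm p g)) (ℕ.*-assoc g p d′))))))
      p∤d′ : ¬ p ∣ d′
      p∤d′ p∣d′ = p∤m (∣-trans p∣d′ (quotient-∣ g∣m))
      s : Carrier
      s = ℤ→R R (μ d′)
      IHk : φ d′ × c′ k ≈ φ m × s
      IHk = IH′ k d′ g*d′≡m
      φpd′c′≈φpm·s : φ (p * d′) × c′ k ≈ φ (p * m) × s
      φpd′c′≈φpm·s = cancel-φ m p∤m s (begin
        φ (p * d′) × c′ k + φ m × s             ≈⟨ +-congˡ IHk ⟨
        φ (p * d′) × c′ k + φ d′ × c′ k         ≈⟨ ×-homo-+ (c′ k) (φ (p * d′)) (φ d′) ⟨
        (φ (p * d′) ℕ.+ φ d′) × c′ k            ≡⟨ ≡.cong (_× c′ k) (φ-*-∤ p d′ pp p∤d′) ⟩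
        (p * φ d′) × c′ k                       ≈⟨ ×-assocˡ (c′ k) p (φ d′) ⟨
        p × (φ d′ × c′ k)                       ≈⟨ ×-congʳ p IHk ⟩
        p × (φ m × s)                           ≈⟨ ×-assocˡ s p (φ m) ⟩
        (p * φ m) × s                           ∎)

  hölder-* : ∀ {p m} → Prime p → 1 ≤ m → HölderFormula m → HölderFormula (p * m)
  hölder-* {p} {m} pp m≥1 IH η ηprim k d e with p ∣? m | p ∣? k
  ... | yes p∣m | yes (divides q ≡.refl) = Step.p∣m-p∣k pp m≥1 IH ηprim p∣m q d e
  ... | yes p∣m | no p∤k = Step.p∣m-p∤k pp m≥1 IH ηprim p∣m k p∤k d e
  ... | no p∤m | yes (divides q ≡.refl) = Step.p∤m-p∣k pp m≥1 IH ηprim p∤m q d e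
  ... | no p∤m | no p∤k = Step.p∤m-p∤k pp m≥1 IH ηprim p∤m k p∤k d e

  hölder-product : ∀ {ps} → All Prime ps → HölderFormula (product ps)
  hölder-product [] = hölder-1
  hölder-product (pp ∷ pps) = hölder-* pp (productOfPrimes≥1 pps) (hölder-product pps)

  hölder : ∀ m → 1 ≤ m → HölderFormula m
  hölder (suc m) _ = ≡.subst HölderFormula (≡.sym isFactorisation) (hölder-product factorsPrime)
    where open PrimeFactorisation (factorise (suc m))

module Denominators (n : ℕ) (n≥1 : 1 ≤ n) where

  open ListLemmas
  open Arithmetic
  open import Data.Nat as ℕ using (suc; _*_; _≤_)
  import Data.Nat.Properties as ℕ
  open import Data.Nat.DivMod using (m*[n/m]≡n; m*n/n≡m)
  open import Data.Nat.Divisibility using (_∣_; _∣?_; divides; quotient; m∣n⇒n≡quotient*m; ∣⇒≤; ∣-refl; ∣-antisym)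
  open import Data.Nat.GCD using (gcd; gcd[m,n]∣m; gcd[m,n]∣n; gcd[m,n]≡0⇒n≡0; gcd-identityˡ; gcd-greatest; c*gcd[m,n]≡gcd[cm,cn])
  open import Data.List using (map; filter)
  open import Data.List.Properties using (filter-≐)
  open import Data.List.Membership.Propositional using (_∈_)
  open import Data.List.Membership.Propositional.Properties using (∈-filter⁺; ∈-applyUpTo⁺)
  open import Data.Product using (_×_; _,_; proj₂)
  open import Function using (_⇔_; mk⇔; Equivalence)
  open import Relation.Unary using (Decidable)
  open import Relation.Binary.PropositionalEquality
  open ≡-Reasoning

  divℕ-cancel : ∀ {g m} → 1 ≤ g → g ∣ m → g * (m divℕ g) ≡ m
  divℕ-cancel {suc g} _ g∣m = m*[n/m]≡n g∣m

  *-divℕ : ∀ {e} d → 1 ≤ e → (e * d) divℕ e ≡ d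
  *-divℕ {suc e} d _ = trans (cong (ℕ._/ suc e) (ℕ.*-comm (suc e) d)) (m*n/n≡m d (suc e))

  denom : ℕ → ℕ
  denom k = n divℕ gcd k n

  gcd*denom≡n : ∀ k → gcd k n * denom k ≡ n
  gcd*denom≡n k = divℕ-cancel (ℕ.n≢0⇒n>0 (λ g≡0 → ℕ.<⇒≢ n≥1 (sym (gcd[m,n]≡0⇒n≡0 k g≡0)))) (gcd[m,n]∣n k n)

  denom∈divisors : ∀ k → denom k ∈ divisors n
  denom∈divisors k with denom k in e | factor-positiveʳ {gcd k n} (gcd*denom≡n k) n≥1
  ... | suc d | _ = ∈-filter⁺ (_∣? n) (subst (suc d ∈_) (sym (range1≡applyUpTo n)) (∈-applyUpTo⁺ suc (∣⇒≤ {{ℕ.>-nonZero n≥1}} d∣n))) d∣n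
    where
    d∣n : suc d ∣ n
    d∣n = divides (gcd k n) (trans (sym (gcd*denom≡n k)) (cong (gcd k n *_) e))

  denom-n≡1 : ∀ k → gcd k n ≡ n → denom k ≡ 1
  denom-n≡1 k g≡n = trans (cong (n divℕ_) g≡n) (trans (cong (_divℕ n) (sym (ℕ.*-identityʳ n))) (*-divℕ 1 n≥1))

  denom[0]≡1 : denom 0 ≡ 1
  denom[0]≡1 = denom-n≡1 0 (gcd-identityˡ n)

  denom[n]≡1 : denom n ≡ 1
  denom[n]≡1 = denom-n≡1 n (∣-antisym (gcd[m,n]∣n n n) (gcd-greatest ∣-refl ∣-refl))

  module _ {d : ℕ} (d∣n : d ∣ n) where

    private
      d≥1 : 1 ≤ d
      d≥1 = factor-positiveʳ {quotient d∣n} (sym (m∣n⇒n≡quotient*m d∣n)) n≥1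
      e : ℕ
      e = n divℕ d
      n≡e*d : n ≡ e * d
      n≡e*d = trans (sym (divℕ-cancel d≥1 d∣n)) (ℕ.*-comm d e)
      e≥1 : 1 ≤ e
      e≥1 = factor-positiveˡ {e} (sym n≡e*d) n≥1
      gcd≟e : Decidable (λ k → gcd k n ≡ e)
      gcd≟e k = gcd k n ℕ.≟ e

      denom≡d⇔gcd≡e : ∀ k → denom k ≡ d ⇔ gcd k n ≡ e
      denom≡d⇔gcd≡e k = mk⇔
        (λ denom≡d → ℕ.*-cancelʳ-≡ (gcd k n) e d {{ℕ.>-nonZero d≥1}} (trans (cong (gcd k n *_) (sym denom≡d)) (trans (gcd*denom≡n k) n≡e*d)))
        (λ g≡e → trans (cong (n divℕ_) g≡e) (trans (cong (_divℕ e) n≡e*d) (*-divℕ d e≥1)))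

      gcd[ej,n]≡e⇔gcd[j,d]≡1 : ∀ j → gcd (e * j) n ≡ e ⇔ gcd j d ≡ 1
      gcd[ej,n]≡e⇔gcd[j,d]≡1 j = mk⇔
        (λ h → ℕ.*-cancelˡ-≡ (gcd j d) 1 e {{ℕ.>-nonZero e≥1}} (trans (sym factor) (trans h (sym (ℕ.*-identityʳ e)))))
        (λ h → trans factor (trans (cong (e *_) h) (ℕ.*-identityʳ e)))
        where
        factor : gcd (e * j) n ≡ e * gcd j d
        factor = trans (cong (gcd (e * j)) n≡e*d) (sym (c*gcd[m,n]≡gcd[cm,cn] e j d))

    denom-* : ∀ j → gcd j d ≡ 1 → denom (n divℕ d * j) ≡ d
    denom-* j gcd≡1 = Equivalence.from (denom≡d⇔gcd≡e (e * j)) (Equivalence.from (gcd[ej,n]≡e⇔gcd[j,d]≡1 j) gcd≡1)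

    fibre-denom : filter (λ k → denom k ℕ.≟ d) (range 1 n) ≡ map (n divℕ d *_) (coprimes d)
    fibre-denom = begin
      filter (λ k → denom k ℕ.≟ d) (range 1 n)              ≡⟨ filter-≐ (λ k → denom k ℕ.≟ d) gcd≟e (⇔⇒≐ denom≡d⇔gcd≡e) (range 1 n) ⟩
      filter gcd≟e (range 1 n)                               ≡⟨ cong (λ z → filter gcd≟e (range 1 z)) n≡e*d ⟩
      filter gcd≟e (range 1 (e * d))                         ≡⟨ filter-filter (e ∣?_) gcd≟e gcd≟e e∣k×gcd≡e⇔gcd≡e (range 1 (e * d)) ⟨
      filter gcd≟e (filter (e ∣?_) (range 1 (e * d)))        ≡⟨ cong (filter gcd≟e) (filter-∣-range1 e e≥1 d) ⟩
      filter gcd≟e (map (e *_) (range 1 d))                  ≡⟨ filter-map gcd≟e (e *_) (range 1 d) ⟩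
      map (e *_) (filter (λ j → gcd≟e (e * j)) (range 1 d))  ≡⟨ cong (map (e *_)) (filter-≐ (λ j → gcd≟e (e * j)) (coprime? d) (⇔⇒≐ gcd[ej,n]≡e⇔gcd[j,d]≡1) (range 1 d)) ⟩
      map (e *_) (coprimes d)                                ∎
      where
      e∣k×gcd≡e⇔gcd≡e : ∀ k → (e ∣ k × gcd k n ≡ e) ⇔ gcd k n ≡ e
      e∣k×gcd≡e⇔gcd≡e k = mk⇔ proj₂ (λ g≡e → subst (_∣ k) g≡e (gcd[m,n]∣m k n) , g≡e)

module RationalSums where

  open Arithmetic using (coprime?; coprimes)
  open import Data.Nat as ℕ using (zero; suc; _≤_)
  import Data.Nat.Properties as ℕ
  open import Data.Nat.Divisibility using (_∣_; _∣?_)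
  open import Data.Nat.GCD using (gcd)
  open import Data.List.Membership.Propositional using (_∈_)
  open import Data.Integer as ℤ using (ℤ)
  import Data.Integer.Properties as ℤ
  open import Data.Rational as ℚ using (ℚ; _+_; _*_; _-_; -_; 0ℚ; 1ℚ)
  import Data.Rational.Properties as ℚ
  open import Data.Rational.Unnormalised as ℚᵘ using (mkℚᵘ; *≡*)
  import Data.Rational.Unnormalised.Properties as ℚᵘ
  open import Data.List using (upTo; map; filter)
  open import Data.List.Membership.Propositional.Properties using (∈-filter⁻)
  open import Data.List.Relation.Unary.Unique.Propositional using (Unique)
  import Data.List.Relation.Unary.Unique.Propositional.Properties as Unique
  open import Data.Product using (_×_; _,_; proj₂)
  open import Relation.Binary.PropositionalEquality
  open ≡-Reasoning
  open Sums (CommutativeRing.commutativeSemiring ℚ.+-*-commutativeRing) public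

  ^ℚ-+ : ∀ y a b → y ^ℚ (a ℕ.+ b) ≡ y ^ℚ a * y ^ℚ b
  ^ℚ-+ y zero b = sym (ℚ.*-identityˡ _)
  ^ℚ-+ y (suc a) b = trans (cong (y *_) (^ℚ-+ y a b)) (sym (ℚ.*-assoc y _ _))

  ^ℚ-* : ∀ y a b → (y ^ℚ a) ^ℚ b ≡ y ^ℚ (a ℕ.* b)
  ^ℚ-* y a zero = cong (y ^ℚ_) (sym (ℕ.*-zeroʳ a))
  ^ℚ-* y a (suc b) = trans (cong (y ^ℚ a *_) (^ℚ-* y a b)) (trans (sym (^ℚ-+ y a (a ℕ.* b))) (cong (y ^ℚ_) (sym (ℕ.*-suc a b))))

  /1≡*÷ℚ : ∀ f N c m → 1 ≤ f → ℤ.+ f ℤ.* c ≡ ℤ.+ N ℤ.* m → c ℚ./ 1 ≡ (ℤ.+ N ℚ./ 1) * (m ÷ℚ f)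
  /1≡*÷ℚ (suc b) N c m _ fc≡Nm = ℚ.toℚᵘ-injective (ℚᵘ.≃-trans (ℚ.toℚᵘ-fromℚᵘ (mkℚᵘ c 0))
    (ℚᵘ.≃-trans cross (ℚᵘ.≃-sym (ℚᵘ.≃-trans (ℚ.toℚᵘ-homo-* (ℤ.+ N ℚ./ 1) (m ℚ./ suc b))
       (ℚᵘ.*-cong (ℚ.toℚᵘ-fromℚᵘ (mkℚᵘ (ℤ.+ N) 0)) (ℚ.toℚᵘ-fromℚᵘ (mkℚᵘ m b)))))))
    where
    cross : mkℚᵘ c 0 ℚᵘ.≃ (mkℚᵘ (ℤ.+ N) 0 ℚᵘ.* mkℚᵘ m b)
    cross = *≡* (trans (cong (λ z → c ℤ.* ℤ.+ z) (ℕ.*-identityˡ (suc b)))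
      (trans (ℤ.*-comm c (ℤ.+ suc b)) (trans fc≡Nm (sym (ℤ.*-identityʳ _)))))

  divisors-unique : ∀ n → Unique (divisors n)
  divisors-unique n = Unique.filter⁺ (_∣? n) (Unique.map⁺ ℕ.suc-injective (Unique.upTo⁺ n))

  module _ {n : ℕ} (n≥1 : 1 ≤ n) where

    open Denominators n n≥1

    Σ-divisors-Ψ : ∀ (A : ℕ → ℚ) x →
      Σ (divisors n) (λ d → A d * Ψ d (x ^ℚ (n divℕ d))) ≡ Σ (range 1 n) (λ k → A (denom k) * x ^ℚ k)
    Σ-divisors-Ψ A x = sym (trans (Σ-partition ℕ._≟_ denom b (divisors n) (divisors-unique n) (range 1 n) (λ {k} _ → denom∈divisors k))
      (Σ-cong∈ (divisors n) (λ {d} d∈ → fibre-sum d (proj₂ (∈-filter⁻ (_∣? n) {xs = range 1 n} d∈)))))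
      where
      b : ℕ → ℚ
      b k = A (denom k) * x ^ℚ k
      fibre-sum : ∀ d → d ∣ n → Σ (fibre ℕ._≟_ denom b d (range 1 n)) b ≡ A d * Ψ d (x ^ℚ (n divℕ d))
      fibre-sum d d∣n = begin
        Σ (filter (λ k → denom k ℕ.≟ d) (range 1 n)) b             ≡⟨ cong (λ l → Σ l b) (fibre-denom d∣n) ⟩
        Σ (map (e ℕ.*_) (coprimes d)) b                             ≡⟨ Σ-map (e ℕ.*_) (coprimes d) b ⟩
        Σ (coprimes d) (λ j → b (e ℕ.* j))                          ≡⟨ Σ-cong∈ (coprimes d) (λ {j} j∈ → term j (∈-filter⁻ (coprime? d) {xs = range 1 d} j∈)) ⟩
        Σ (coprimes d) (λ j → A d * (x ^ℚ e) ^ℚ j)                  ≡⟨ Σ-*ˡ (coprimes d) (A d) _ ⟨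
        A d * Ψ d (x ^ℚ e)                                          ∎
        where
        e : ℕ
        e = n divℕ d
        term : ∀ j → j ∈ range 1 d × gcd j d ≡ 1 → b (e ℕ.* j) ≡ A d * (x ^ℚ e) ^ℚ j
        term j (_ , gcd≡1) = cong₂ _*_ (cong A (denom-* d∣n j gcd≡1)) (sym (^ℚ-* x e j))

    Σ-upTo-rotate : ∀ (b : ℕ → ℚ) y → b 0 ≡ 1ℚ → b n ≡ y → Σ (upTo n) b ≡ (1ℚ - y) + Σ (range 1 n) b
    Σ-upTo-rotate b y b0≡1 bn≡y = begin
      S                         ≡⟨ ℚ.+-identityʳ S ⟨
      S + 0ℚ                    ≡⟨ cong (S +_) (ℚ.+-inverseʳ y) ⟨
      S + (y - y)               ≡⟨ ℚ.+-assoc S y (- y) ⟨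
      (S + y) - y               ≡⟨ cong (λ z → z - y) (trans (cong (S +_) (sym bn≡y)) (trans (Σ-upTo-+-last n b) (cong (_+ Sr) b0≡1))) ⟩
      (1ℚ + Sr) - y             ≡⟨ ℚ.+-assoc 1ℚ Sr (- y) ⟩
      1ℚ + (Sr - y)             ≡⟨ cong (1ℚ +_) (ℚ.+-comm Sr (- y)) ⟩
      1ℚ + (- y + Sr)           ≡⟨ ℚ.+-assoc 1ℚ (- y) Sr ⟨
      (1ℚ - y) + Sr             ∎
      where
      S Sr : ℚ
      S = Σ (upTo n) b
      Sr = Σ (range 1 n) b

module _ {a ℓ} (R : CommutativeRing a ℓ) (domain : IsIntegralDomain R) (charZero : HasCharZero R)
         {n : ℕ} (n≥1 : n ≥ 1) {ζ : CommutativeRing.Carrier R} (ζprim : IsPrimitiveRoot R n ζ) where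

  open import Data.Integer as ℤ using (+_)
  open import Data.Rational as ℚ using (_*_)
  open CommutativeRing R using (_≈_)
  open RingFacts R using (ℤ→R-×; ℤ→R-injective; ×-congʳ)
  open Denominators n n≥1

  ramSum-coefficient : (c : ℕ → ℤ) → (∀ k → ramSum R n ζ k ≈ ℤ→R R (c k)) →
    ∀ k → c k ℚ./ 1 ≡ (+ φ n ℚ./ 1) * (μ (denom k) ÷ℚ φ (denom k))
  ramSum-coefficient c c≈ k = RationalSums./1≡*÷ℚ (φ (denom k)) (φ n) (c k) (μ (denom k))
    (Totient.φ-positive (denom k) (Arithmetic.factor-positiveʳ {gcd k n} (gcd*denom≡n k) n≥1))
    (ℤ→R-injective charZero _ _ (begin
      ℤ→R R (+ φ (denom k) ℤ.* c k)     ≈⟨ ℤ→R-× (φ (denom k)) (c k) ⟨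
      φ (denom k) × ℤ→R R (c k)         ≈⟨ ×-congʳ (φ (denom k)) (c≈ k) ⟨
      φ (denom k) × ramSum R n ζ k      ≈⟨ Hölder.hölder R domain n n≥1 ζ ζprim k (denom k) (gcd*denom≡n k) ⟩
      φ n × ℤ→R R (μ (denom k))         ≈⟨ ℤ→R-× (φ n) (μ (denom k)) ⟩
      ℤ→R R (+ φ n ℤ.* μ (denom k))     ∎))
    where
    open import Data.Nat.GCD using (gcd)
    open import Algebra.Definitions.RawSemiring (Semiring.rawSemiring (CommutativeRing.semiring R)) using (_×_)
    open import Relation.Binary.Reasoning.Setoid (CommutativeRing.setoid R)

theorem9 : {a ℓ : Level} (R : CommutativeRing a ℓ) →
    IsIntegralDomain R → HasCharZero R →
    (n : ℕ) → n ≥ 1 → (ζ : CommutativeRing.Carrier R) → IsPrimitiveRoot R n ζ →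
    (c : ℕ → ℤ) →
    (∀ k → CommutativeRing._≈_ R (ramSum R n ζ k) (ℤ→R R (c k))) →
    (x : ℚ) → Rpoly n c x ≡ RHS n x
theorem9 R domain charZero n n≥1 ζ ζprim c c≈ x = begin
  Rpoly n c x                                 ≡⟨ Σ-cong (upTo n) (λ k → trans (cong (_* x ^ℚ k) (coefficient k)) (ℚ.*-assoc Φ _ _)) ⟩
  Σ (upTo n) (λ k → Φ * b k)                  ≡⟨ Σ-*ˡ (upTo n) Φ b ⟨
  Φ * Σ (upTo n) b                            ≡⟨ cong (Φ *_) (Σ-upTo-rotate n≥1 b _ b[0]≡1 b[n]≡xⁿ) ⟩
  Φ * ((1ℚ - x ^ℚ n) + Σ (range 1 n) b)      ≡⟨ cong (λ s → Φ * ((1ℚ - x ^ℚ n) + s)) (Σ-divisors-Ψ n≥1 A x) ⟨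
  RHS n x                                     ∎
  where
  open import Data.Integer using (+_)
  open import Data.Rational using (_+_; _*_; _-_; 1ℚ)
  import Data.Rational.Properties as ℚ
  open import Data.List using (upTo)
  open import Relation.Binary.PropositionalEquality using (cong; trans; module ≡-Reasoning)
  open ≡-Reasoning
  open RationalSums
  open Denominators n n≥1 using (denom; denom[0]≡1; denom[n]≡1)
  A : ℕ → ℚ
  A d = μ d ÷ℚ φ d
  Φ : ℚ
  Φ = + φ n Data.Rational./ 1
  b : ℕ → ℚ
  b k = A (denom k) * x ^ℚ k
  coefficient : ∀ k → c k Data.Rational./ 1 ≡ Φ * A (denom k)
  coefficient = ramSum-coefficient R domain charZero n≥1 ζprim c c≈
  b[0]≡1 : b 0 ≡ 1ℚ
  b[0]≡1 = trans (cong (λ d → A d * 1ℚ) denom[0]≡1) (ℚ.*-identityʳ 1ℚ)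
  b[n]≡xⁿ : b n ≡ x ^ℚ n
  b[n]≡xⁿ = trans (cong (λ d → A d * x ^ℚ n) denom[n]≡1) (ℚ.*-identityˡ _)
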